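{- Let $\Sigma$ be a signed alphabet. Consider the rewriting system $\mathrm{Col}_2(\Sigma)$ on the free monoid generated by the symbols $c_u$, where $u$ ranges over nonempty super columns over $\Sigma$. Its rules are $$\gamma_{u,v}:\ c_uc_v\Rightarrow c_wc_{w'},$$ one for each pair of nonempty super columns $u,v$ such that the topmost juxtaposition of $[u]_r$ and $[v]_r$ does not form a super tableau. Here: - if $[uv]_r$ has two columns, $w$ and $w'$ are the readings of its left and right columns respectively; - if $[uv]_r$ has one column, $w=uv$ and $c_{w'}$ is the empty word. Then $\mathrm{Col}_2(\Sigma)$ is convergent (terminating and confluent), and the monoid it presents is isomorphic to the super plactic monoid $\mathbf{P}(\Sigma)$.
   Context: A signed alphabet is a finite or countable totally ordered set $\Sigma$ with a map $\|\cdot\|:\Sigma\to\mathbb{Z}_2$; write $\Sigma_0=\|\cdot\|^{ -1}(0)$ and $\Sigma_1=\|\cdot\|^{ -1}(1)$. A super column is a word $x_1\ldots x_k$ over $\Sigma$ with $x_{i+1}\le x_i$, where $x_i=x_{i+1}$ only if $\|x_i\|=1$. A super tableau is a filling $T$ of a Young diagram by elements of $\Sigma$ such that: - $T(i,j)\le T(i,j+1)$, with equality only if $\|T(i,j)\|=0$; - $T(i,j)\le T(i+1,j)$, with equality only if $\|T(i,j)\|=1$. The reading of a column lists its entries from bottom to top. Right insertion $t\leftarrow x$ works as follows. - If $x\in\Sigma_0$ (resp. $\Sigma_1$) is $\ge$ (resp. $>$) the last entry of the top row, append it to that row. - Otherwise, $x$ replaces the smallest entry $y$ of the top row with $y>x$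 (resp. $y\ge x$), and $y$ is inserted in the same way into the next row (a new row if none). $[w]_r$ denotes the result of inserting the letters of $w$ from left to right into the empty tableau. For super columns $u=x_1\ldots x_p$ and $v=y_1\ldots y_q$, the topmost juxtaposition of $[u]_r$ and $[v]_r$ forms a super tableau iff $p\ge q$ and $x_i\le y_i$ for all $i\le q$, with $x_i=y_i$ only if $\|x_i\|=0$. $\mathbf{P}(\Sigma)$ is the quotient of $\Sigma^*$ by the congruence generated by the following relations: - $zxy=xzy$ for $x\le y\le z$, with $x=y$ only if $\|y\|=0$ and $y=z$ only if $\|y\|=1$; - $yzx=yxz$ for $x\le y\le z$, with $x=y$ only if $\|y\|=1$ and $y=z$ only if $\|y\|=0$. -}

module Defs where

open import Level using (0ℓ)
open import Data.Bool using (Bool; true; false; if_then_else_; _∧_; _∨_; not; T)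
open import Data.Nat using (ℕ; zero; suc; _≡ᵇ_)
open import Data.List using (List; []; _∷_; [_]; _++_; foldl; length; reverse; mapMaybe; null)
open import Data.List.Relation.Unary.All using (All)
open import Data.List.Relation.Unary.Linked using (Linked)
open import Data.Maybe using (Maybe; just; nothing)
import Data.Maybe as Maybe
open import Data.Product using (Σ; ∃; _×_; _,_; proj₁)
open import Data.Sum using (_⊎_)
open import Data.Unit using (⊤)
open import Data.Empty using (⊥)
open import Function using (flip)
open import Function.Bundles using (_↣_)
open import Relation.Binary using (Rel; IsStrictTotalOrder)
open import Relation.Binary.PropositionalEquality using (_≡_)
open import Relation.Nullary using (¬_)
open import Relation.Nullary.Decidable using (⌊_⌋)
open import Induction.WellFounded using (WellFounded)
open import Relation.Binary.Construct.Closure.ReflexiveTransitive using (Star)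
open import Relation.Binary.Construct.Closure.Equivalence using (EqClosure)

-- Signed alphabets: a countable (finite or infinite) totally ordered set
-- with a parity map into Z/2 (false = 0, true = 1).

record SignedAlphabet : Set₁ where
  field
    Carrier     : Set
    _<_         : Rel Carrier 0ℓ
    isSTO       : IsStrictTotalOrder _≡_ _<_
    parity      : Carrier → Bool
    countable   : Carrier ↣ ℕ
  open IsStrictTotalOrder isSTO public using (_<?_; _≟_)

  _≤_ : Rel Carrier 0ℓ
  x ≤ y = x < y ⊎ x ≡ y

module _ (S : SignedAlphabet) where
  open SignedAlphabet S

  -- Super columns (boolean-valued, so that generators c_u are determined
  -- by the word u alone).

  colB : Carrier → Carrier → Bool
  colB a b = ⌊ a <? b ⌋ ∨ (⌊ a ≟ b ⌋ ∧ parity a)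

  superColumn? : List Carrier → Bool
  superColumn? []            = true
  superColumn? (x ∷ [])      = true
  superColumn? (x ∷ y ∷ r)   = colB y x ∧ superColumn? (y ∷ r)

  nonemptySuperColumn? : List Carrier → Bool
  nonemptySuperColumn? u = not (null u) ∧ superColumn? u

  Col : Set
  Col = Σ (List Carrier) (λ u → T (nonemptySuperColumn? u))

  word : Col → List Carrier
  word = proj₁

  -- Tableaux as lists of rows (top row first, each row left to right).

  Tableau : Set
  Tableau = List (List Carrier)

  RowRel : Rel Carrier 0ℓ
  RowRel a b = a < b ⊎ (a ≡ b × parity a ≡ false)

  ColRel : Rel Carrier 0ℓ
  ColRel a b = a < b ⊎ (a ≡ b × parity a ≡ true)

  Below : List Carrier → List Carrier → Set
  Below _       []        = ⊤
  Below []      (_ ∷ _)   = ⊥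
  Below (a ∷ r) (b ∷ r')  = ColRel a b × Below r r'

  NonEmpty : List Carrier → Set
  NonEmpty []      = ⊥
  NonEmpty (_ ∷ _) = ⊤

  IsSuperTableau : Tableau → Set
  IsSuperTableau t = All (λ r → NonEmpty r × Linked RowRel r) t × Linked Below t

  bumps : Carrier → Carrier → Bool
  bumps x y = if parity x then ⌊ x <? y ⌋ ∨ ⌊ x ≟ y ⌋ else ⌊ x <? y ⌋

  insRow : Carrier → List Carrier → List Carrier × Maybe Carrier
  insRow x []      = [ x ] , nothing
  insRow x (y ∷ r) with bumps x y
  ... | true  = x ∷ r , just y
  ... | false with insRow x r
  ...   | r' , m = y ∷ r' , m

  insert : Tableau → Carrier → Tableau
  insert []           x = [ x ] ∷ []
  insert (row ∷ rows) x with insRow x row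
  ... | row' , nothing = row' ∷ rows
  ... | row' , just y  = row' ∷ insert rows y

  rect : List Carrier → Tableau
  rect = foldl insert []

  nth : List Carrier → ℕ → Maybe Carrier
  nth []      _       = nothing
  nth (x ∷ _) zero    = just x
  nth (_ ∷ r) (suc n) = nth r n

  width : Tableau → ℕ
  width []      = 0
  width (r ∷ _) = length r

  -- reading of the j-th column (0-based): entries from bottom to top
  readingCol : ℕ → Tableau → List Carrier
  readingCol j t = reverse (mapMaybe (λ r → nth r j) t)

  -- topmost juxtaposition of t and s (s placed to the right of t,
  -- top rows aligned).  Returns nothing when the filled shape is not a
  -- Young diagram (a row of s would not sit directly after column
  -- width t, e.g. s has more rows than t).
  juxtW : ℕ → Tableau → Tableau → Maybe Tableau
  juxtW w rs       []       = just rs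
  juxtW w []       (s ∷ ss) = nothing
  juxtW w (r ∷ rs) (s ∷ ss) =
    if length r ≡ᵇ w then Maybe.map ((r ++ s) ∷_) (juxtW w rs ss) else nothing

  juxt : Tableau → Tableau → Maybe Tableau
  juxt t s = juxtW (width t) t s

  FormsSuperTableau : Tableau → Tableau → Set
  FormsSuperTableau t s = ∃ λ j → juxt t s ≡ just j × IsSuperTableau j

  data Rule : List Col → List Col → Set where
    γ-two : (u v w w' : Col) →
            ¬ FormsSuperTableau (rect (word u)) (rect (word v)) →
            width (rect (word u ++ word v)) ≡ 2 →
            word w  ≡ readingCol 0 (rect (word u ++ word v)) →
            word w' ≡ readingCol 1 (rect (word u ++ word v)) →
            Rule (u ∷ v ∷ []) (w ∷ w' ∷ [])
    γ-one : (u v w : Col) →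
            ¬ FormsSuperTableau (rect (word u)) (rect (word v)) →
            width (rect (word u ++ word v)) ≡ 1 →
            word w ≡ word u ++ word v →
            Rule (u ∷ v ∷ []) (w ∷ [])

  data Step : List Col → List Col → Set where
    step : ∀ (x y : List Col) {l r} → Rule l r → Step (x ++ l ++ y) (x ++ r ++ y)

  Terminating : Set
  Terminating = WellFounded (flip Step)

  Confluent : Set
  Confluent = ∀ {a b c} → Star Step a b → Star Step a c →
              ∃ λ d → Star Step b d × Star Step c d

  _≈Col_ : Rel (List Col) 0ℓ
  _≈Col_ = EqClosure Step

  data PRel : List Carrier → List Carrier → Set where
    knuth₁ : ∀ {x y z} → x ≤ y → y ≤ z →
             (x ≡ y → parity y ≡ false) → (y ≡ z → parity y ≡ true) →
             PRel (z ∷ x ∷ y ∷ []) (x ∷ z ∷ y ∷ [])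
    knuth₂ : ∀ {x y z} → x ≤ y → y ≤ z →
             (x ≡ y → parity y ≡ true) → (y ≡ z → parity y ≡ false) →
             PRel (y ∷ z ∷ x ∷ []) (y ∷ x ∷ z ∷ [])

  data PStep : List Carrier → List Carrier → Set where
    pstep : ∀ (x y : List Carrier) {l r} → PRel l r → PStep (x ++ l ++ y) (x ++ r ++ y)

  _≈P_ : Rel (List Carrier) 0ℓ
  _≈P_ = EqClosure PStep

  MonoidIso : Set
  MonoidIso = Σ (List Col → List Carrier) λ f →
      (f [] ≈P [])
    × (∀ s t → f (s ++ t) ≈P (f s ++ f t))
    × (∀ s t → s ≈Col t → f s ≈P f t)
    × (∀ s t → f s ≈P f t → s ≈Col t)
    × (∀ w → ∃ λ s → f s ≈P w)

{-# OPTIONS --safe #-}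
module Submission where

-- Right insertion is invariant under the super plactic relations (a row-bumping
-- argument), and every word is congruent to the row reading of its tableau, so two
-- words are congruent exactly when they have the same tableau [w]_r.  A rule
-- c_u c_v ⇒ c_w c_w′ replaces u v by the columns of [uv]_r, so it preserves the
-- tableau of the underlying word; since the clash forces the left column to grow,
-- letters move to the left and rewriting terminates.  In a normal form every two
-- adjacent columns juxtapose, so inserting its word just appends the columns one by
-- one: a normal form is the list of columns of its tableau, hence unique.  This
-- gives confluence, and c_u ↦ u induces the isomorphism with P(Σ).

open import Defs
open import Data.Bool using (true; false; if_then_else_; _∨_; not; T)
open import Data.Bool.Properties using (∧-identityʳ; ∧-zeroʳ; ∨-identityʳ; T-∧; T-≡; T-irrelevant)
open import Function.Bundles using (Equivalence)
open import Data.Nat using (ℕ; suc; _+_; z≤n; s≤s) renaming (_≤_ to _≤ℕ_; _<_ to _<ℕ_)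
open import Data.Nat.Properties
  using (+-commutativeSemigroup; +-suc; +-identityʳ; ≤-trans; ≤-reflexive; <-≤-trans; m≤m+n; m<m+n; +-monoʳ-<; +-monoˡ-<; +-mono-<-≤; +-cancelˡ-<)
open import Data.Nat.Induction using (<-wellFounded)
open import Algebra.Properties.CommutativeSemigroup +-commutativeSemigroup using (x∙yz≈y∙xz)
open import Data.List using (List; []; _∷_; [_]; _++_; _∷ʳ_; _?∷_; _∷ʳ?_; foldl; length; reverse; map; null; mapMaybe; concat; concatMap)
open import Data.List.Properties
  using (foldl-++; unfold-reverse; reverse-++; reverse-involutive; reverse-injective; ++-assoc; ++-identityʳ; ++-conicalˡ; ++-conicalʳ; map-++; concat-++; length-++; length-reverse; map-injective; ∷-injectiveˡ; ∷-injectiveʳ)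
open import Data.List.Relation.Unary.All as All using (All; []; _∷_)
open import Data.List.Relation.Unary.All.Properties using (++⁺; ∷ʳ⁺; ∷ʳ⁻; map⁺)
open import Data.List.Relation.Unary.Linked as Linked using (Linked; []; [-]; _∷_)
open import Data.List.Relation.Unary.Linked.Properties using (Linked⇒All) renaming (map⁺ to Linked-map⁺)
open import Data.Maybe using (Maybe; just; nothing)
open import Data.Maybe.Relation.Unary.All using (just; nothing) renaming (All to Maybe-All)
open import Data.Product using (∃; ∃₂; _×_; _,_; proj₁; proj₂)
open import Data.Product.Properties using (,-injective)
open import Data.Sum using (_⊎_; inj₁; inj₂; [_,_]′)
open import Data.Unit using (⊤; tt)
open import Data.Empty using (⊥; ⊥-elim)
open import Function using (_∘_; flip)
open import Relation.Nullary using (¬_; yes; no)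
open import Relation.Nullary.Decidable using (⌊_⌋)
open import Relation.Binary using (Transitive; tri<; tri≈; tri>; IsStrictTotalOrder)
open import Relation.Binary.PropositionalEquality hiding ([_])
import Relation.Binary.Construct.Closure.Equivalence as Eq
import Relation.Binary.Construct.On as On
open import Induction.WellFounded using (module Subrelation; Acc; acc)
open import Relation.Binary.Construct.Closure.ReflexiveTransitive using (Star; ε; _◅_; _◅◅_)
import Relation.Binary.Construct.Closure.ReflexiveTransitive as Star
open import Relation.Binary.Construct.Closure.Symmetric using (fwd)

Linked⇒All-head : {A : Set} {R : A → A → Set} → Transitive R →
                  ∀ {x xs} → Linked R (x ∷ xs) → All (R x) xs
Linked⇒All-head R-trans [-] = []
Linked⇒All-head R-trans (Rxy ∷ Rxs) = Linked⇒All R-trans Rxy Rxs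

All⇒Linked-∷ : {A : Set} {R : A → A → Set} → ∀ {x xs} → All (R x) xs → Linked R xs → Linked R (x ∷ xs)
All⇒Linked-∷ [] _ = [-]
All⇒Linked-∷ (Rxy ∷ _) Rxs = Rxy ∷ Rxs

All-reverse : {A : Set} {P : A → Set} → ∀ {w} → All P w → All P (reverse w)
All-reverse {w = x ∷ w} (px ∷ pw) = subst (All _) (sym (unfold-reverse x w)) (∷ʳ⁺ (All-reverse pw) px)
All-reverse [] = []

Linked-∷ʳ : {A : Set} {R : A → A → Set} → ∀ {xs x} → Linked R xs → All (λ y → R y x) xs → Linked R (xs ∷ʳ x)
Linked-∷ʳ [] _ = [-]
Linked-∷ʳ [-] (Ryx ∷ []) = Ryx ∷ [-]
Linked-∷ʳ (Ryz ∷ Rzs) (_ ∷ Rzsx) = Ryz ∷ Linked-∷ʳ Rzs Rzsx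

Linked-reverse : {A : Set} {R : A → A → Set} → Transitive R →
                 ∀ {w} → Linked (flip R) w → Linked R (reverse w)
Linked-reverse R-trans {[]} _ = []
Linked-reverse R-trans {x ∷ w} Rw =
  subst (Linked _) (sym (unfold-reverse x w))
    (Linked-∷ʳ (Linked-reverse R-trans (Linked.tail Rw)) (All-reverse (Linked⇒All-head (flip R-trans) Rw)))

Linked-++⁻ˡ : {A : Set} {R : A → A → Set} → ∀ xs {ys} → Linked R (xs ++ ys) → Linked R xs
Linked-++⁻ˡ [] _ = []
Linked-++⁻ˡ (_ ∷ []) _ = [-]
Linked-++⁻ˡ (_ ∷ _ ∷ xs) (Rxy ∷ Rxs) = Rxy ∷ Linked-++⁻ˡ (_ ∷ xs) Rxs

summand-< : ∀ {a b c d} → a <ℕ c → c + d ≡ a + b → d <ℕ b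
summand-< {a} {b} {c} {d} a<c eq = +-cancelˡ-< a d b (subst (a + d <ℕ_) eq (+-monoˡ-< d a<c))

module _ (S : SignedAlphabet) where
  open SignedAlphabet S
  open IsStrictTotalOrder isSTO using (compare; irrefl; asym) renaming (trans to <-trans)

  -- Column and row orders

  infix 4 _<ᶜ_ _≤ʳ_

  -- x <ᶜ y: x may lie directly above y in a column (x < y, or x = y odd);
  -- x ≤ʳ y: x may lie directly left of y in a row (x < y, or x = y even).
  _<ᶜ_ : Carrier → Carrier → Set
  x <ᶜ y = bumps S x y ≡ true

  _≤ʳ_ : Carrier → Carrier → Set
  x ≤ʳ y = bumps S y x ≡ false

  <⇒<ᶜ : ∀ {x y} → x < y → x <ᶜ y
  <⇒<ᶜ {x} {y} x<y with parity x | x <? y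
  ... | true  | yes _ = refl
  ... | false | yes _ = refl
  ... | _     | no x≮y = ⊥-elim (x≮y x<y)

  <⇒≤ʳ : ∀ {x y} → x < y → x ≤ʳ y
  <⇒≤ʳ {x} {y} x<y with parity y | y <? x | y ≟ x
  ... | _     | yes y<x | _        = ⊥-elim (asym x<y y<x)
  ... | true  | no _    | yes refl = ⊥-elim (irrefl refl x<y)
  ... | true  | no _    | no _     = refl
  ... | false | no _    | _        = refl

  bumps-refl : ∀ x → bumps S x x ≡ parity x
  bumps-refl x with parity x | x <? x | x ≟ x
  ... | _     | yes x<x | _       = ⊥-elim (irrefl refl x<x)
  ... | true  | no _    | yes _   = refl
  ... | true  | no _    | no x≢x = ⊥-elim (x≢x refl)
  ... | false | no _    | _       = refl

  trichotomy : ∀ x y → x < y ⊎ x ≡ y ⊎ y < x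
  trichotomy x y with compare x y
  ... | tri< x<y _ _ = inj₁ x<y
  ... | tri≈ _ x≡y _ = inj₂ (inj₁ x≡y)
  ... | tri> _ _ y<x = inj₂ (inj₂ y<x)

  <ᶜ⇒ColRel : ∀ {x y} → x <ᶜ y → ColRel S x y
  <ᶜ⇒ColRel {x} {y} x<ᶜy with trichotomy x y
  ... | inj₁ x<y = inj₁ x<y
  ... | inj₂ (inj₁ refl) = inj₂ (refl , trans (sym (bumps-refl x)) x<ᶜy)
  ... | inj₂ (inj₂ y<x) with () ← trans (sym (<⇒≤ʳ y<x)) x<ᶜy

  ≤ʳ⇒RowRel : ∀ {x y} → x ≤ʳ y → RowRel S x y
  ≤ʳ⇒RowRel {x} {y} x≤ʳy with trichotomy x y
  ... | inj₁ x<y = inj₁ x<y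
  ... | inj₂ (inj₁ refl) = inj₂ (refl , trans (sym (bumps-refl x)) x≤ʳy)
  ... | inj₂ (inj₂ y<x) with () ← trans (sym (<⇒<ᶜ y<x)) x≤ʳy

  RowRel⇒≤ʳ : ∀ {x y} → RowRel S x y → x ≤ʳ y
  RowRel⇒≤ʳ (inj₁ x<y) = <⇒≤ʳ x<y
  RowRel⇒≤ʳ {x} (inj₂ (refl , even)) = trans (bumps-refl x) even

  <ᶜ-or-≤ʳ : ∀ x y → x <ᶜ y ⊎ y ≤ʳ x
  <ᶜ-or-≤ʳ x y with bumps S x y
  ... | true  = inj₁ refl
  ... | false = inj₂ refl

  <ᶜ⇒≱ʳ : ∀ {x y} → x <ᶜ y → ¬ y ≤ʳ x
  <ᶜ⇒≱ʳ x<ᶜy y≤ʳx with () ← trans (sym x<ᶜy) y≤ʳx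

  <ᶜ-trans : ∀ {x y z} → x <ᶜ y → y <ᶜ z → x <ᶜ z
  <ᶜ-trans p q with <ᶜ⇒ColRel p | <ᶜ⇒ColRel q
  ... | inj₁ x<y        | inj₁ y<z        = <⇒<ᶜ (<-trans x<y y<z)
  ... | inj₁ x<y        | inj₂ (refl , _) = <⇒<ᶜ x<y
  ... | inj₂ (refl , _) | _               = q

  ≤ʳ-trans : ∀ {x y z} → x ≤ʳ y → y ≤ʳ z → x ≤ʳ z
  ≤ʳ-trans p q with ≤ʳ⇒RowRel p | ≤ʳ⇒RowRel q
  ... | inj₁ x<y        | inj₁ y<z        = <⇒≤ʳ (<-trans x<y y<z)
  ... | inj₁ x<y        | inj₂ (refl , _) = <⇒≤ʳ x<y
  ... | inj₂ (refl , _) | _               = q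

  -- A row equality is even and a column equality is odd, so at most one step is an equality.
  ≤ʳ-<ᶜ⇒< : ∀ {x y z} → x ≤ʳ y → y <ᶜ z → x < z
  ≤ʳ-<ᶜ⇒< p q with ≤ʳ⇒RowRel p | <ᶜ⇒ColRel q
  ... | inj₁ x<y           | inj₁ y<z          = <-trans x<y y<z
  ... | inj₁ x<y           | inj₂ (refl , _)   = x<y
  ... | inj₂ (refl , _)    | inj₁ y<z          = y<z
  ... | inj₂ (refl , even) | inj₂ (refl , odd) with () ← trans (sym even) odd

  <ᶜ-≤ʳ⇒< : ∀ {x y z} → x <ᶜ y → y ≤ʳ z → x < z
  <ᶜ-≤ʳ⇒< p q with <ᶜ⇒ColRel p | ≤ʳ⇒RowRel q
  ... | inj₁ x<y          | inj₁ y<z           = <-trans x<y y<z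
  ... | inj₁ x<y          | inj₂ (refl , _)    = x<y
  ... | inj₂ (refl , _)   | inj₁ y<z           = y<z
  ... | inj₂ (refl , odd) | inj₂ (refl , even) with () ← trans (sym even) odd

  ≤ʳ-<ᶜ⇒<ᶜ : ∀ {x y z} → x ≤ʳ y → y <ᶜ z → x <ᶜ z
  ≤ʳ-<ᶜ⇒<ᶜ p q = <⇒<ᶜ (≤ʳ-<ᶜ⇒< p q)

  <ᶜ-≤ʳ⇒<ᶜ : ∀ {x y z} → x <ᶜ y → y ≤ʳ z → x <ᶜ z
  <ᶜ-≤ʳ⇒<ᶜ p q = <⇒<ᶜ (<ᶜ-≤ʳ⇒< p q)

  ≤ʳ-<ᶜ⇒≤ʳ : ∀ {x y z} → x ≤ʳ y → y <ᶜ z → x ≤ʳ z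
  ≤ʳ-<ᶜ⇒≤ʳ p q = <⇒≤ʳ (≤ʳ-<ᶜ⇒< p q)

  <ᶜ-≤ʳ⇒≤ʳ : ∀ {x y z} → x <ᶜ y → y ≤ʳ z → x ≤ʳ z
  <ᶜ-≤ʳ⇒≤ʳ p q = <⇒≤ʳ (<ᶜ-≤ʳ⇒< p q)

  ≤⇒≤ʳ : ∀ {x y} → x ≤ y → (x ≡ y → parity y ≡ false) → x ≤ʳ y
  ≤⇒≤ʳ (inj₁ x<y) _ = <⇒≤ʳ x<y
  ≤⇒≤ʳ {x} (inj₂ refl) even = trans (bumps-refl x) (even refl)

  ≤⇒<ᶜ : ∀ {x y} → x ≤ y → (x ≡ y → parity y ≡ true) → x <ᶜ y
  ≤⇒<ᶜ (inj₁ x<y) _ = <⇒<ᶜ x<y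
  ≤⇒<ᶜ {x} (inj₂ refl) odd = trans (bumps-refl x) (odd refl)

  ≤ʳ⇒≤ : ∀ {x y} → x ≤ʳ y → x ≤ y × (x ≡ y → parity y ≡ false)
  ≤ʳ⇒≤ x≤ʳy with ≤ʳ⇒RowRel x≤ʳy
  ... | inj₁ x<y = inj₁ x<y , λ { refl → ⊥-elim (irrefl refl x<y) }
  ... | inj₂ (refl , even) = inj₂ refl , λ _ → even

  <ᶜ⇒≤ : ∀ {x y} → x <ᶜ y → x ≤ y × (x ≡ y → parity y ≡ true)
  <ᶜ⇒≤ x<ᶜy with <ᶜ⇒ColRel x<ᶜy
  ... | inj₁ x<y = inj₁ x<y , λ { refl → ⊥-elim (irrefl refl x<y) }
  ... | inj₂ (refl , odd) = inj₂ refl , λ _ → odd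

  -- Row insertion

  IsColumn IsRow : List Carrier → Set
  IsColumn = Linked _<ᶜ_
  IsRow = Linked _≤ʳ_

  insRow-bump : ∀ {x y r} → x <ᶜ y → insRow S x (y ∷ r) ≡ (x ∷ r , just y)
  insRow-bump x<ᶜy rewrite x<ᶜy = refl

  insRow-pass : ∀ {x y r} → y ≤ʳ x → insRow S x (y ∷ r) ≡ (y ∷ proj₁ (insRow S x r) , proj₂ (insRow S x r))
  insRow-pass y≤ʳx rewrite y≤ʳx = refl

  insRow-pass′ : ∀ {x y r r′ m} → y ≤ʳ x → insRow S x r ≡ (r′ , m) → insRow S x (y ∷ r) ≡ (y ∷ r′ , m)
  insRow-pass′ y≤ʳx eq rewrite y≤ʳx | eq = refl

  insRow-append : ∀ {x} r → All (_≤ʳ x) r → insRow S x r ≡ (r ++ [ x ] , nothing)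
  insRow-append [] [] = refl
  insRow-append (y ∷ r) (y≤ʳx ∷ r≤ʳx) = insRow-pass′ y≤ʳx (insRow-append r r≤ʳx)

  insRow-middle : ∀ {x y} r s → All (_≤ʳ x) r → x <ᶜ y → insRow S x (r ++ y ∷ s) ≡ (r ++ x ∷ s , just y)
  insRow-middle [] s [] x<ᶜy = insRow-bump x<ᶜy
  insRow-middle (z ∷ r) s (z≤ʳx ∷ r≤ʳx) x<ᶜy = insRow-pass′ z≤ʳx (insRow-middle r s r≤ʳx x<ᶜy)

  insRow-All : ∀ {P : Carrier → Set} x r → All P r → P x → All P (proj₁ (insRow S x r))
  insRow-All x [] _ px = px ∷ []
  insRow-All x (e ∷ r) (pe ∷ pr) px with <ᶜ-or-≤ʳ x e
  ... | inj₁ x<ᶜe rewrite insRow-bump {r = r} x<ᶜe = px ∷ pr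
  ... | inj₂ e≤ʳx rewrite insRow-pass {r = r} e≤ʳx = pe ∷ insRow-All x r pr px

  insRow-bumped-All : ∀ {P : Carrier → Set} x r → All P r → Maybe-All P (proj₂ (insRow S x r))
  insRow-bumped-All x [] _ = nothing
  insRow-bumped-All x (e ∷ r) (pe ∷ pr) with <ᶜ-or-≤ʳ x e
  ... | inj₁ x<ᶜe rewrite insRow-bump {r = r} x<ᶜe = just pe
  ... | inj₂ e≤ʳx rewrite insRow-pass {r = r} e≤ʳx = insRow-bumped-All x r pr

  insRow-bumped-above : ∀ x r → Maybe-All (x <ᶜ_) (proj₂ (insRow S x r))
  insRow-bumped-above x [] = nothing
  insRow-bumped-above x (e ∷ r) with <ᶜ-or-≤ʳ x e
  ... | inj₁ x<ᶜe rewrite insRow-bump {r = r} x<ᶜe = just x<ᶜe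
  ... | inj₂ e≤ʳx rewrite insRow-pass {r = r} e≤ʳx = insRow-bumped-above x r

  insRow-nothing : ∀ x r {r′} → insRow S x r ≡ (r′ , nothing) → r′ ≡ r ++ [ x ]
  insRow-nothing x [] refl = refl
  insRow-nothing x (e ∷ r) eq with <ᶜ-or-≤ʳ x e
  ... | inj₁ x<ᶜe with () ← trans (sym (insRow-bump {r = r} x<ᶜe)) eq
  ... | inj₂ e≤ʳx with ,-injective (trans (sym (insRow-pass {r = r} e≤ʳx)) eq)
  ...   | refl , m≡ = cong (e ∷_) (insRow-nothing x r (cong (proj₁ (insRow S x r) ,_) m≡))

  -- The last component says that t is x or an entry of r.
  insRow-just-head : ∀ x r {r′ y} → insRow S x r ≡ (r′ , just y) →
                     ∃₂ λ t rest → r′ ≡ t ∷ rest × t <ᶜ y × ((P : Carrier → Set) → All P r → P x → P t)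
  insRow-just-head x (e ∷ r) eq with <ᶜ-or-≤ʳ x e
  ... | inj₁ x<ᶜe with trans (sym (insRow-bump {r = r} x<ᶜe)) eq
  ...   | refl = x , r , refl , x<ᶜe , λ _ _ px → px
  insRow-just-head x (e ∷ r) eq | inj₂ e≤ʳx with ,-injective (trans (sym (insRow-pass {r = r} e≤ʳx)) eq)
  ...   | refl , m≡ = e , proj₁ (insRow S x r) , refl , ≤ʳ-<ᶜ⇒<ᶜ e≤ʳx (x<ᶜbumped m≡ (insRow-bumped-above x r)) ,
                      λ { _ (pe ∷ _) _ → pe }
    where
    x<ᶜbumped : ∀ {m y} → m ≡ just y → Maybe-All (x <ᶜ_) m → x <ᶜ y
    x<ᶜbumped refl (just x<ᶜy) = x<ᶜy

  insRow-row : ∀ x r → IsRow r → IsRow (proj₁ (insRow S x r))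
  insRow-row x [] _ = [-]
  insRow-row x (e ∷ r) row with <ᶜ-or-≤ʳ x e
  ... | inj₁ x<ᶜe rewrite insRow-bump {r = r} x<ᶜe =
    All⇒Linked-∷ (All.map (<ᶜ-≤ʳ⇒≤ʳ x<ᶜe) (Linked⇒All-head ≤ʳ-trans row)) (Linked.tail row)
  ... | inj₂ e≤ʳx rewrite insRow-pass {r = r} e≤ʳx =
    All⇒Linked-∷ (insRow-All x r (Linked⇒All-head ≤ʳ-trans row) e≤ʳx) (insRow-row x r (Linked.tail row))

  insRowWord : List Carrier → List Carrier → List Carrier × List Carrier
  insRowWord r [] = r , []
  insRowWord r (x ∷ w) =
    let (r′ , m) = insRow S x r
        (r″ , bumped) = insRowWord r′ w
    in r″ , m ?∷ bumped

  insertWord : Tableau S → List Carrier → Tableau S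
  insertWord = foldl (insert S)

  insertWord-++ : ∀ T u v → insertWord T (u ++ v) ≡ insertWord (insertWord T u) v
  insertWord-++ = foldl-++ (insert S)

  insertWord-∷ : ∀ r T w → insertWord (r ∷ T) w ≡ proj₁ (insRowWord r w) ∷ insertWord T (proj₂ (insRowWord r w))
  insertWord-∷ r T [] = refl
  insertWord-∷ r T (x ∷ w) with insRow S x r
  ... | r′ , nothing = insertWord-∷ r′ T w
  ... | r′ , just y = insertWord-∷ r′ (insert S T y) w

  insRowWord-∷ʳ : ∀ r w x → insRowWord r (w ∷ʳ x) ≡
    (let (r′ , bumped) = insRowWord r w
         (r″ , m) = insRow S x r′
     in r″ , bumped ∷ʳ? m)
  insRowWord-∷ʳ r [] x with proj₂ (insRow S x r)
  ... | nothing = refl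
  ... | just _  = refl
  insRowWord-∷ʳ r (y ∷ w) x rewrite insRowWord-∷ʳ (proj₁ (insRow S y r)) w x =
    cong (proj₁ (insRow S x (proj₁ (insRowWord r (y ∷ w)))) ,_)
      (?∷-∷ʳ? (proj₂ (insRow S y r)) (proj₂ (insRowWord (proj₁ (insRow S y r)) w))
        (proj₂ (insRow S x (proj₁ (insRowWord r (y ∷ w))))))
    where
    ?∷-∷ʳ? : ∀ m b n → m ?∷ (b ∷ʳ? n) ≡ (m ?∷ b) ∷ʳ? n
    ?∷-∷ʳ? nothing b n = refl
    ?∷-∷ʳ? (just y) b nothing = refl
    ?∷-∷ʳ? (just y) b (just z) = refl

  insert-rows : ∀ T x → All IsRow T → All IsRow (insert S T x)
  insert-rows [] x _ = [-] ∷ []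
  insert-rows (r ∷ T) x (row ∷ rows) with insRow S x r in eq
  ... | r′ , nothing = subst IsRow (cong proj₁ eq) (insRow-row x r row) ∷ rows
  ... | r′ , just y  = subst IsRow (cong proj₁ eq) (insRow-row x r row) ∷ insert-rows T y rows

  insertWord-rows : ∀ T w → All IsRow T → All IsRow (insertWord T w)
  insertWord-rows T [] rows = rows
  insertWord-rows T (x ∷ w) rows = insertWord-rows (insert S T x) w (insert-rows T x rows)

  -- Inserting a column into a column

  insert-column : ∀ a U → IsColumn (a ∷ U) → insert S (map [_] U) a ≡ [ a ] ∷ map [_] U
  insert-column a [] _ = refl
  insert-column a (b ∷ U) (a<ᶜb ∷ col) rewrite insRow-bump {r = []} a<ᶜb = cong ([ a ] ∷_) (insert-column b U col)

  rect-column : ∀ U → IsColumn U → insertWord [] (reverse U) ≡ map [_] U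
  rect-column [] _ = refl
  rect-column (a ∷ U) col
    rewrite unfold-reverse a U | insertWord-++ [] (reverse U) [ a ] | rect-column U (Linked.tail col) =
    insert-column a U col

  bumpHead : Carrier → List Carrier × List Carrier → List Carrier × List Carrier
  bumpHead b ([] , bumped) = [ b ] , bumped
  bumpHead b (x ∷ row , bumped) = b ∷ row , x ∷ bumped

  -- Inserting a column V, listed top to bottom and hence inserted from its last entry,
  -- into the one-cell row [ a ]: the resulting row and the bumped letters, top to bottom.
  insCell : Carrier → List Carrier → List Carrier × List Carrier
  insCell a [] = [ a ] , []
  insCell a (b ∷ V) = if bumps S b a then bumpHead b (insCell a V) else (a ∷ b ∷ [] , V)

  insCell-bump : ∀ {a b} V → b <ᶜ a → insCell a (b ∷ V) ≡ bumpHead b (insCell a V)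
  insCell-bump V b<ᶜa rewrite b<ᶜa = refl

  insCell-stop : ∀ {a b} V → a ≤ʳ b → insCell a (b ∷ V) ≡ (a ∷ b ∷ [] , V)
  insCell-stop V a≤ʳb rewrite a≤ʳb = refl

  data AtMostOne : List Carrier → Set where
    none : AtMostOne []
    one  : ∀ y → AtMostOne [ y ]

  BelowHeadOf : List Carrier → Carrier → Set
  BelowHeadOf [] e = ⊥
  BelowHeadOf (y ∷ _) e = y <ᶜ e

  Contains : List Carrier → Carrier → Set
  Contains l a = ∃₂ λ P R → l ≡ P ++ a ∷ R

  record InsCell (a : Carrier) (V : List Carrier) : Set₁ where
    field
      lead            : Carrier
      rest bumped     : List Carrier
      computes        : insCell a V ≡ (lead ∷ rest , bumped)
      rest-short      : AtMostOne rest
      lead-≤a         : lead ≡ a ⊎ lead <ᶜ a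
      from-a∷V        : (P : Carrier → Set) → P a → All P V → P lead × All P bumped
      rest-from-V     : (P : Carrier → Set) → All P V → All P rest
      lead<ᶜbumped    : All (lead <ᶜ_) bumped
      rest-right      : All (λ y → lead ≤ʳ y × a ≤ʳ y) rest
      bumped-bound    : All (λ e → e <ᶜ a ⊎ e ≡ a ⊎ BelowHeadOf rest e) bumped
      bumped-column   : IsColumn bumped
      a-kept          : lead ≡ a ⊎ Contains bumped a
      a-bumped        : ∀ {b V′} → V ≡ b ∷ V′ → b <ᶜ a → Contains bumped a
      no-rest         : rest ≡ [] → lead ∷ bumped ≡ V ++ [ a ]
      sizes           : length rest + length bumped ≡ length V

  insCell-spec : ∀ a V → IsColumn V → InsCell a V
  insCell-spec a [] _ = record
    { lead = a ; rest = [] ; bumped = [] ; computes = refl ; rest-short = none ; lead-≤a = inj₁ refl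
    ; from-a∷V = λ _ pa _ → pa , [] ; rest-from-V = λ _ _ → [] ; lead<ᶜbumped = [] ; rest-right = []
    ; bumped-bound = [] ; bumped-column = [] ; a-kept = inj₁ refl ; a-bumped = λ () ; no-rest = λ _ → refl
    ; sizes = refl }
  insCell-spec a (b ∷ V) col with <ᶜ-or-≤ʳ b a
  ... | inj₂ a≤ʳb = record
    { lead = a ; rest = [ b ] ; bumped = V ; computes = insCell-stop V a≤ʳb ; rest-short = one b
    ; lead-≤a = inj₁ refl ; from-a∷V = λ _ pa pbV → pa , All.tail pbV
    ; rest-from-V = λ _ pbV → All.head pbV ∷ [] ; lead<ᶜbumped = All.map (≤ʳ-<ᶜ⇒<ᶜ a≤ʳb) b<ᶜV
    ; rest-right = (a≤ʳb , a≤ʳb) ∷ [] ; bumped-bound = All.map (λ b<ᶜe → inj₂ (inj₂ b<ᶜe)) b<ᶜV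
    ; bumped-column = Linked.tail col ; a-kept = inj₁ refl
    ; a-bumped = λ { refl b<ᶜa → ⊥-elim (<ᶜ⇒≱ʳ b<ᶜa a≤ʳb) } ; no-rest = λ () ; sizes = refl }
    where
    b<ᶜV : All (b <ᶜ_) V
    b<ᶜV = Linked⇒All-head <ᶜ-trans col
  ... | inj₁ b<ᶜa = record
    { lead = b ; rest = rest ; bumped = lead ∷ bumped
    ; computes = trans (insCell-bump V b<ᶜa) (cong (bumpHead b) computes)
    ; rest-short = rest-short ; lead-≤a = inj₂ b<ᶜa
    ; from-a∷V = λ P pa pbV → All.head pbV , (proj₁ (from-a∷V P pa (All.tail pbV)) ∷ proj₂ (from-a∷V P pa (All.tail pbV)))
    ; rest-from-V = λ P pbV → rest-from-V P (All.tail pbV)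
    ; lead<ᶜbumped = proj₁ b<ᶜlead×bumped ∷ proj₂ b<ᶜlead×bumped
    ; rest-right = All.map (λ (_ , a≤ʳy) → <ᶜ-≤ʳ⇒≤ʳ b<ᶜa a≤ʳy , a≤ʳy) rest-right
    ; bumped-bound = [ (λ lead≡a → inj₂ (inj₁ lead≡a)) , inj₁ ]′ lead-≤a ∷ bumped-bound
    ; bumped-column = All⇒Linked-∷ lead<ᶜbumped bumped-column
    ; a-kept = inj₂ a-in-bumped ; a-bumped = λ _ _ → a-in-bumped
    ; no-rest = λ rest≡[] → cong (b ∷_) (no-rest rest≡[])
    ; sizes = trans (+-suc (length rest) (length bumped)) (cong suc sizes) }
    where
    open InsCell (insCell-spec a V (Linked.tail col))
    b<ᶜlead×bumped : b <ᶜ lead × All (b <ᶜ_) bumped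
    b<ᶜlead×bumped = from-a∷V (b <ᶜ_) b<ᶜa (Linked⇒All-head <ᶜ-trans col)
    a-in-bumped : Contains (lead ∷ bumped) a
    a-in-bumped = [ (λ lead≡a → [] , bumped , cong (_∷ bumped) lead≡a)
                  , (λ (P , R , eq) → lead ∷ P , R , cong (lead ∷_) eq) ]′ a-kept

  insRowWord-cell : ∀ a V → IsColumn V → insRowWord [ a ] (reverse V) ≡ (proj₁ (insCell a V) , reverse (proj₂ (insCell a V)))
  insRowWord-cell a [] _ = refl
  insRowWord-cell a (b ∷ V) col
    with <ᶜ-or-≤ʳ b a | insCell-spec a V (Linked.tail col) | insRowWord-cell a V (Linked.tail col)
  ... | inj₁ b<ᶜa | R | ih
    rewrite unfold-reverse b V | insRowWord-∷ʳ [ a ] (reverse V) b | ih | insCell-bump V b<ᶜa | InsCell.computes R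
          | insRow-bump {r = InsCell.rest R} (proj₁ (InsCell.from-a∷V R (b <ᶜ_) b<ᶜa (Linked⇒All-head <ᶜ-trans col))) =
    cong (b ∷ InsCell.rest R ,_) (sym (unfold-reverse (InsCell.lead R) (InsCell.bumped R)))
  insRowWord-cell a (b ∷ []) _ | inj₂ a≤ʳb | _ | _ rewrite insRow-pass {r = []} a≤ʳb | insCell-stop [] a≤ʳb = refl
  insRowWord-cell a (b ∷ b₂ ∷ V) (b<ᶜb₂ ∷ _) | inj₂ a≤ʳb | _ | ih
    rewrite insCell-stop {b = b} (b₂ ∷ V) a≤ʳb | unfold-reverse b (b₂ ∷ V) | insRowWord-∷ʳ [ a ] (reverse (b₂ ∷ V)) b
          | ih | insCell-stop V (≤ʳ-<ᶜ⇒≤ʳ a≤ʳb b<ᶜb₂) | insRow-pass {r = [ b₂ ]} a≤ʳb | insRow-bump {r = []} b<ᶜb₂ =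
    cong (a ∷ b ∷ [] ,_) (sym (unfold-reverse b₂ V))

  insColumn : List Carrier → List Carrier → Tableau S
  insColumn [] V = map [_] V
  insColumn (a ∷ U) V = proj₁ (insCell a V) ∷ insColumn U (proj₂ (insCell a V))

  insCell-bumped-column : ∀ a V → IsColumn V → IsColumn (proj₂ (insCell a V))
  insCell-bumped-column a V colV = subst IsColumn (cong proj₂ (sym computes)) bumped-column
    where open InsCell (insCell-spec a V colV)

  insertWord-column : ∀ U V → IsColumn U → IsColumn V → insertWord (map [_] U) (reverse V) ≡ insColumn U V
  insertWord-column [] V _ colV = rect-column V colV
  insertWord-column (a ∷ U) V colU colV = begin
    insertWord ([ a ] ∷ map [_] U) (reverse V)
      ≡⟨ insertWord-∷ [ a ] (map [_] U) (reverse V) ⟩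
    proj₁ (insRowWord [ a ] (reverse V)) ∷ insertWord (map [_] U) (proj₂ (insRowWord [ a ] (reverse V)))
      ≡⟨ cong (λ (row , w) → row ∷ insertWord (map [_] U) w) (insRowWord-cell a V colV) ⟩
    proj₁ (insCell a V) ∷ insertWord (map [_] U) (reverse (proj₂ (insCell a V)))
      ≡⟨ cong (proj₁ (insCell a V) ∷_)
           (insertWord-column U (proj₂ (insCell a V)) (Linked.tail colU) (insCell-bumped-column a V colV)) ⟩
    insColumn (a ∷ U) V ∎
    where open ≡-Reasoning

  -- Left column C and right column D, both listed top to bottom.
  twoColumns : List Carrier → List Carrier → Tableau S
  twoColumns [] _ = []
  twoColumns (c ∷ C) [] = [ c ] ∷ twoColumns C []
  twoColumns (c ∷ C) (d ∷ D) = (c ∷ d ∷ []) ∷ twoColumns C D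

  twoColumns-[] : ∀ V → map [_] V ≡ twoColumns V []
  twoColumns-[] [] = refl
  twoColumns-[] (v ∷ V) = cong ([ v ] ∷_) (twoColumns-[] V)

  Juxtaposable : List Carrier → List Carrier → Set
  Juxtaposable _ [] = ⊤
  Juxtaposable [] (_ ∷ _) = ⊥
  Juxtaposable (c ∷ C) (d ∷ D) = c ≤ʳ d × Juxtaposable C D

  Clash : List Carrier → List Carrier → Set
  Clash _ [] = ⊥
  Clash [] (_ ∷ _) = ⊤
  Clash (c ∷ C) (d ∷ D) = d <ᶜ c ⊎ Clash C D

  juxtaposable-or-clash : ∀ C D → Juxtaposable C D ⊎ Clash C D
  juxtaposable-or-clash C [] = inj₁ tt
  juxtaposable-or-clash [] (d ∷ D) = inj₂ tt
  juxtaposable-or-clash (c ∷ C) (d ∷ D) with <ᶜ-or-≤ʳ d c | juxtaposable-or-clash C D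
  ... | inj₁ d<ᶜc | _ = inj₂ (inj₁ d<ᶜc)
  ... | inj₂ c≤ʳd | inj₁ jux = inj₁ (c≤ʳd , jux)
  ... | inj₂ _ | inj₂ clash = inj₂ (inj₂ clash)

  Juxtaposable⇒length≤ : ∀ C D → Juxtaposable C D → length D ≤ℕ length C
  Juxtaposable⇒length≤ C [] _ = z≤n
  Juxtaposable⇒length≤ (c ∷ C) (d ∷ D) (_ , jux) = s≤s (Juxtaposable⇒length≤ C D jux)

  clash-at : ∀ {a} U P R → All (a <ᶜ_) U → Clash U (P ++ a ∷ R)
  clash-at [] [] R _ = tt
  clash-at [] (_ ∷ _) R _ = tt
  clash-at (u ∷ U) [] R (a<ᶜu ∷ _) = inj₁ a<ᶜu
  clash-at (u ∷ U) (_ ∷ P) R (_ ∷ a<ᶜU) = inj₂ (clash-at U P R a<ᶜU)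

  RightOfHead : List Carrier → Carrier → Set
  RightOfHead [] e = ⊥
  RightOfHead (u ∷ _) e = u ≤ʳ e

  record InsColumn (U V : List Carrier) : Set₁ where
    field
      left right        : List Carrier
      tableau           : insColumn U V ≡ twoColumns left right
      left-column       : IsColumn left
      right-column      : IsColumn right
      juxtaposable      : Juxtaposable left right
      left-from         : (P : Carrier → Set) → All P U → All P V → All P left
      right-from        : (P : Carrier → Set) → All (λ e → RightOfHead U e → P e) V → All P right
      longer-if-clash   : Clash U V → length U <ℕ length left
      same-if-juxtaposable : Juxtaposable U V → left ≡ U × right ≡ V
      one-column        : right ≡ [] → left ≡ V ++ U
      total-size        : length left + length right ≡ length U + length V

  ¬RightOfHead : ∀ {a e} U → All (a <ᶜ_) U → e <ᶜ a ⊎ e ≡ a → ¬ RightOfHead U e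
  ¬RightOfHead (u ∷ _) (a<ᶜu ∷ _) e≤a u≤ʳe =
    <ᶜ⇒≱ʳ ([ (λ e<ᶜa → <ᶜ-trans e<ᶜa a<ᶜu) , (λ { refl → a<ᶜu }) ]′ e≤a) u≤ʳe

  All-BelowHeadOf-[] : ∀ {l} → All (BelowHeadOf []) l → l ≡ []
  All-BelowHeadOf-[] [] = refl

  module InsColumn-∷ {a U V} (colU : IsColumn (a ∷ U)) (R : InsCell a V) (I : InsColumn U (InsCell.bumped R)) where
    open InsCell R
    open InsColumn I

    a<ᶜU : All (a <ᶜ_) U
    a<ᶜU = Linked⇒All-head <ᶜ-trans colU

    blocked : ∀ {e} → e <ᶜ a ⊎ e ≡ a → ¬ RightOfHead U e
    blocked = ¬RightOfHead U a<ᶜU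

    right-below-rest : All (BelowHeadOf rest) right
    right-below-rest = right-from _ (All.map below bumped-bound)
      where
      below : ∀ {e} → e <ᶜ a ⊎ e ≡ a ⊎ BelowHeadOf rest e → RightOfHead U e → BelowHeadOf rest e
      below (inj₁ e<ᶜa) h = ⊥-elim (blocked (inj₁ e<ᶜa) h)
      below (inj₂ (inj₁ e≡a)) h = ⊥-elim (blocked (inj₂ e≡a) h)
      below (inj₂ (inj₂ e-below)) _ = e-below

    tableau-∷ : ∀ {r} → AtMostOne r → All (BelowHeadOf r) right →
                (lead ∷ r) ∷ twoColumns left right ≡ twoColumns (lead ∷ left) (r ++ right)
    tableau-∷ none below rewrite All-BelowHeadOf-[] below = refl
    tableau-∷ (one y) _ = refl

    column-∷ : ∀ {r} → AtMostOne r → All (BelowHeadOf r) right → IsColumn (r ++ right)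
    column-∷ none _ = right-column
    column-∷ (one y) below = All⇒Linked-∷ below right-column

    juxtaposable-∷ : ∀ {r} → AtMostOne r → All (BelowHeadOf r) right → All (λ y → lead ≤ʳ y × a ≤ʳ y) r →
                     Juxtaposable (lead ∷ left) (r ++ right)
    juxtaposable-∷ none below _ rewrite All-BelowHeadOf-[] below = tt
    juxtaposable-∷ (one y) _ ((lead≤ʳy , _) ∷ []) = lead≤ʳy , juxtaposable

    lead<ᶜU : All (lead <ᶜ_) U
    lead<ᶜU = [ (λ { refl → a<ᶜU }) , (λ lead<ᶜa → All.map (<ᶜ-trans lead<ᶜa) a<ᶜU) ]′ lead-≤a

    lift-right-from : {P : Carrier → Set} → All (λ e → a ≤ʳ e → P e) V → All (λ e → RightOfHead U e → P e) bumped
    lift-right-from {P} hyp = proj₂ (from-a∷V _ (λ h → ⊥-elim (blocked (inj₂ refl) h)) (All.map lift hyp))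
      where
      lift : ∀ {e} → (a ≤ʳ e → P e) → RightOfHead U e → P e
      lift {e} h h′ with <ᶜ-or-≤ʳ e a
      ... | inj₁ e<ᶜa = ⊥-elim (blocked (inj₁ e<ᶜa) h′)
      ... | inj₂ a≤ʳe = h a≤ʳe

    bumped-after-stop : ∀ {b V′} → V ≡ b ∷ V′ → a ≤ʳ b → lead ≡ a × rest ≡ [ b ] × bumped ≡ V′
    bumped-after-stop {V′ = V′} refl a≤ʳb with ,-injective (trans (sym computes) (insCell-stop V′ a≤ʳb))
    ... | row≡ , bumped≡ = ∷-injectiveˡ row≡ , ∷-injectiveʳ row≡ , bumped≡

    clash-bumped : ∀ {W} → V ≡ W → Clash (a ∷ U) W → Clash U bumped
    clash-bumped {b ∷ V′} V≡ clash with <ᶜ-or-≤ʳ b a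
    ... | inj₁ b<ᶜa with a-bumped V≡ b<ᶜa
    ...   | P , Q , bumped≡ = subst (Clash U) (sym bumped≡) (clash-at U P Q a<ᶜU)
    clash-bumped {b ∷ V′} V≡ (inj₁ b<ᶜa) | inj₂ a≤ʳb = ⊥-elim (<ᶜ⇒≱ʳ b<ᶜa a≤ʳb)
    clash-bumped {b ∷ V′} V≡ (inj₂ clash) | inj₂ a≤ʳb =
      subst (Clash U) (sym (proj₂ (proj₂ (bumped-after-stop V≡ a≤ʳb)))) clash

    juxtaposable-cell : ∀ {W} → V ≡ W → Juxtaposable (a ∷ U) W → lead ≡ a × rest ++ bumped ≡ W × Juxtaposable U bumped
    juxtaposable-cell {[]} refl _ with ,-injective (sym computes)
    ... | refl , refl = refl , refl , tt
    juxtaposable-cell {b ∷ V′} V≡ (a≤ʳb , jux) with bumped-after-stop V≡ a≤ʳb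
    ... | lead≡a , refl , refl = lead≡a , refl , jux

    one-column-∷ : rest ++ right ≡ [] → lead ∷ left ≡ V ++ a ∷ U
    one-column-∷ empty = begin
      lead ∷ left         ≡⟨ cong (lead ∷_) (one-column (++-conicalʳ rest right empty)) ⟩
      (lead ∷ bumped) ++ U ≡⟨ cong (_++ U) (no-rest (++-conicalˡ rest right empty)) ⟩
      (V ++ [ a ]) ++ U    ≡⟨ ++-assoc V [ a ] U ⟩
      V ++ a ∷ U           ∎
      where open ≡-Reasoning

    total-size-∷ : length left + length (rest ++ right) ≡ length U + length V
    total-size-∷ = begin
      length left + length (rest ++ right)          ≡⟨ cong (length left +_) (length-++ rest) ⟩
      length left + (length rest + length right)    ≡⟨ x∙yz≈y∙xz (length left) (length rest) (length right) ⟩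
      length rest + (length left + length right)    ≡⟨ cong (length rest +_) total-size ⟩
      length rest + (length U + length bumped)      ≡⟨ x∙yz≈y∙xz (length rest) (length U) (length bumped) ⟩
      length U + (length rest + length bumped)      ≡⟨ cong (length U +_) sizes ⟩
      length U + length V                           ∎
      where open ≡-Reasoning

    result : InsColumn (a ∷ U) V
    result = record
      { left = lead ∷ left
      ; right = rest ++ right
      ; tableau = trans (cong (λ (row , B) → row ∷ insColumn U B) computes)
                        (trans (cong ((lead ∷ rest) ∷_) tableau) (tableau-∷ rest-short right-below-rest))
      ; left-column = All⇒Linked-∷ (left-from _ lead<ᶜU lead<ᶜbumped) left-column
      ; right-column = column-∷ rest-short right-below-rest
      ; juxtaposable = juxtaposable-∷ rest-short right-below-rest rest-right
      ; left-from = λ { P (pa ∷ pU) pV → proj₁ (from-a∷V P pa pV) ∷ left-from P pU (proj₂ (from-a∷V P pa pV)) }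
      ; right-from = λ P hyp →
          ++⁺ (All.zipWith (λ (h , (_ , a≤ʳy)) → h a≤ʳy) (rest-from-V _ hyp , rest-right)) (right-from P (lift-right-from hyp))
      ; longer-if-clash = λ clash → s≤s (longer-if-clash (clash-bumped refl clash))
      ; same-if-juxtaposable = λ jux → let (lead≡a , rest++bumped≡V , jux′) = juxtaposable-cell refl jux
                                           (left≡U , right≡bumped) = same-if-juxtaposable jux′
                                       in cong₂ _∷_ lead≡a left≡U , trans (cong (rest ++_) right≡bumped) rest++bumped≡V
      ; one-column = one-column-∷
      ; total-size = cong suc total-size-∷
      }

  insColumn-spec : ∀ U V → IsColumn U → IsColumn V → InsColumn U V
  insColumn-spec [] V _ colV = record
    { left = V ; right = [] ; tableau = twoColumns-[] V ; left-column = colV ; right-column = []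
    ; juxtaposable = tt ; left-from = λ _ _ pV → pV ; right-from = λ _ _ → []
    ; longer-if-clash = clash-[] V ; same-if-juxtaposable = juxtaposable-[] V
    ; one-column = λ _ → sym (++-identityʳ V) ; total-size = +-identityʳ (length V) }
    where
    clash-[] : ∀ V → Clash [] V → 0 <ℕ length V
    clash-[] (_ ∷ _) _ = s≤s z≤n
    juxtaposable-[] : ∀ V → Juxtaposable [] V → V ≡ [] × [] ≡ V
    juxtaposable-[] [] _ = refl , refl
  insColumn-spec (a ∷ U) V colU colV =
    InsColumn-∷.result colU R (insColumn-spec U (InsCell.bumped R) (Linked.tail colU) (InsCell.bumped-column R))
    where
    R : InsCell a V
    R = insCell-spec a V colV

  -- Knuth relations and insertion

  data Knuth : List Carrier → List Carrier → Set where
    knuth₁ : ∀ {x y z} → x ≤ʳ y → y <ᶜ z → Knuth (z ∷ x ∷ y ∷ []) (x ∷ z ∷ y ∷ [])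
    knuth₂ : ∀ {x y z} → x <ᶜ y → y ≤ʳ z → Knuth (y ∷ z ∷ x ∷ []) (y ∷ x ∷ z ∷ [])

  PRel⇒Knuth : ∀ {l l′} → PRel S l l′ → Knuth l l′
  PRel⇒Knuth (knuth₁ x≤y y≤z x≡y⇒even y≡z⇒odd) =
    knuth₁ (≤⇒≤ʳ x≤y x≡y⇒even) (≤⇒<ᶜ y≤z λ { refl → y≡z⇒odd refl })
  PRel⇒Knuth (knuth₂ x≤y y≤z x≡y⇒odd y≡z⇒even) =
    knuth₂ (≤⇒<ᶜ x≤y x≡y⇒odd) (≤⇒≤ʳ y≤z λ { refl → y≡z⇒even refl })

  Knuth⇒PRel : ∀ {l l′} → Knuth l l′ → PRel S l l′
  Knuth⇒PRel (knuth₁ x≤ʳy y<ᶜz) with ≤ʳ⇒≤ x≤ʳy | <ᶜ⇒≤ y<ᶜz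
  ... | x≤y , x≡y⇒even | y≤z , y≡z⇒odd = knuth₁ x≤y y≤z x≡y⇒even (λ { refl → y≡z⇒odd refl })
  Knuth⇒PRel (knuth₂ x<ᶜy y≤ʳz) with <ᶜ⇒≤ x<ᶜy | ≤ʳ⇒≤ y≤ʳz
  ... | x≤y , x≡y⇒odd | y≤z , y≡z⇒even = knuth₂ x≤y y≤z x≡y⇒odd (λ { refl → y≡z⇒even refl })

  KnuthOrEq : List Carrier → List Carrier → Set
  KnuthOrEq w w′ = w ≡ w′ ⊎ Knuth w w′ ⊎ Knuth w′ w

  record KnuthCompatible (r l l′ : List Carrier) : Set where
    constructor _,_
    field
      same-row       : proj₁ (insRowWord r l) ≡ proj₁ (insRowWord r l′)
      related-bumped : KnuthOrEq (proj₂ (insRowWord r l)) (proj₂ (insRowWord r l′))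

  compatible : ∀ {r l l′ R R′ B B′} → insRowWord r l ≡ (R , B) → insRowWord r l′ ≡ (R′ , B′) →
               R ≡ R′ → KnuthOrEq B B′ → KnuthCompatible r l l′
  compatible refl refl R≡R′ B~B′ = R≡R′ , B~B′

  insRowWord-3 : ∀ r a b c {r₁ r₂ r₃ m₁ m₂ m₃} →
                 insRow S a r ≡ (r₁ , m₁) → insRow S b r₁ ≡ (r₂ , m₂) → insRow S c r₂ ≡ (r₃ , m₃) →
                 insRowWord r (a ∷ b ∷ c ∷ []) ≡ (r₃ , m₁ ?∷ m₂ ?∷ m₃ ?∷ [])
  insRowWord-3 r a b c eq₁ eq₂ eq₃ rewrite eq₁ | eq₂ | eq₃ = refl

  insRowWord-knuth-[] : ∀ {l l′} → Knuth l l′ → insRowWord [] l ≡ insRowWord [] l′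
  insRowWord-knuth-[] (knuth₁ {x} {y} {z} x≤ʳy y<ᶜz) =
    trans (insRowWord-3 [] z x y refl (insRow-bump (≤ʳ-<ᶜ⇒<ᶜ x≤ʳy y<ᶜz)) (insRow-pass′ x≤ʳy refl))
          (sym (insRowWord-3 [] x z y refl (insRow-pass′ (≤ʳ-<ᶜ⇒≤ʳ x≤ʳy y<ᶜz) refl)
                                            (insRow-pass′ x≤ʳy (insRow-bump y<ᶜz))))
  insRowWord-knuth-[] (knuth₂ {x} {y} {z} x<ᶜy y≤ʳz) =
    trans (insRowWord-3 [] y z x refl (insRow-pass′ y≤ʳz refl) (insRow-bump x<ᶜy))
          (sym (insRowWord-3 [] y x z refl (insRow-bump x<ᶜy) (insRow-pass′ (<ᶜ-≤ʳ⇒≤ʳ x<ᶜy y≤ʳz) refl)))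

  insertWord-knuth-[] : ∀ {l l′} → Knuth l l′ → insertWord ([] ∷ []) l ≡ insertWord ([] ∷ []) l′
  insertWord-knuth-[] {l} {l′} k = begin
    insertWord ([] ∷ []) l                                   ≡⟨ insertWord-∷ [] [] l ⟩
    proj₁ (insRowWord [] l) ∷ insertWord [] (proj₂ (insRowWord [] l))
      ≡⟨ cong (λ (row , w) → row ∷ insertWord [] w) (insRowWord-knuth-[] k) ⟩
    proj₁ (insRowWord [] l′) ∷ insertWord [] (proj₂ (insRowWord [] l′)) ≡⟨ insertWord-∷ [] [] l′ ⟨
    insertWord ([] ∷ []) l′                                  ∎
    where open ≡-Reasoning

  compatible-[] : ∀ {l l′} → Knuth l l′ → KnuthCompatible [] l l′
  compatible-[] k = cong proj₁ (insRowWord-knuth-[] k) , inj₁ (cong proj₂ (insRowWord-knuth-[] k))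

  compatible-pass : ∀ {e r a b c a′ b′ c′} → e ≤ʳ a → e ≤ʳ b → e ≤ʳ c → e ≤ʳ a′ → e ≤ʳ b′ → e ≤ʳ c′ →
                    KnuthCompatible r (a ∷ b ∷ c ∷ []) (a′ ∷ b′ ∷ c′ ∷ []) →
                    KnuthCompatible (e ∷ r) (a ∷ b ∷ c ∷ []) (a′ ∷ b′ ∷ c′ ∷ [])
  compatible-pass {e} {r} {a} {b} {c} {a′} {b′} {c′} pa pb pc pa′ pb′ pc′ (same , related) =
    compatible (insRowWord-3 (e ∷ r) a b c (insRow-pass pa) (insRow-pass pb) (insRow-pass pc))
               (insRowWord-3 (e ∷ r) a′ b′ c′ (insRow-pass pa′) (insRow-pass pb′) (insRow-pass pc′))
               (cong (e ∷_) same) related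

  -- Row bumping lemma: the second of two row-ordered letters bumps weakly to the right.
  WeaklyBumped : Maybe Carrier → Maybe Carrier → Set
  WeaklyBumped nothing  nothing  = ⊤
  WeaklyBumped nothing  (just _) = ⊥
  WeaklyBumped (just _) nothing  = ⊤
  WeaklyBumped (just y′) (just z′) = y′ ≤ʳ z′

  row-bumping-≤ʳ : ∀ r {y z} → IsRow r → y ≤ʳ z →
                   WeaklyBumped (proj₂ (insRow S y r)) (proj₂ (insRow S z (proj₁ (insRow S y r))))
  row-bumping-≤ʳ [] _ y≤ʳz rewrite y≤ʳz = tt
  row-bumping-≤ʳ (e ∷ r) {y} {z} row y≤ʳz with <ᶜ-or-≤ʳ y e
  ... | inj₁ y<ᶜe rewrite insRow-bump {r = r} y<ᶜe | insRow-pass {r = r} y≤ʳz =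
    weak (insRow-bumped-All z r (Linked⇒All-head ≤ʳ-trans row))
    where
    weak : ∀ {m} → Maybe-All (e ≤ʳ_) m → WeaklyBumped (just e) m
    weak nothing = tt
    weak (just e≤ʳz′) = e≤ʳz′
  ... | inj₂ e≤ʳy rewrite insRow-pass {r = r} e≤ʳy | insRow-pass {r = proj₁ (insRow S y r)} (≤ʳ-trans e≤ʳy y≤ʳz) =
    row-bumping-≤ʳ r (Linked.tail row) y≤ʳz

  -- Row bumping lemma: the second of two column-ordered letters (larger first) always bumps,
  -- strictly to the left, a letter coming from the row.
  StrictlyBumped : (Carrier → Set) → Maybe Carrier → Maybe Carrier → Set
  StrictlyBumped P _         nothing  = ⊥
  StrictlyBumped P nothing   (just y′) = P y′
  StrictlyBumped P (just z′) (just y′) = P y′ × y′ <ᶜ z′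

  row-bumping-<ᶜ : ∀ r {y z} (P : Carrier → Set) → IsRow r → y <ᶜ z → All P r → P z →
                   StrictlyBumped P (proj₂ (insRow S z r)) (proj₂ (insRow S y (proj₁ (insRow S z r))))
  row-bumping-<ᶜ [] P _ y<ᶜz _ pz rewrite y<ᶜz = pz
  row-bumping-<ᶜ (e ∷ r) {y} {z} P row y<ᶜz (pe ∷ pr) pz with <ᶜ-or-≤ʳ z e
  ... | inj₁ z<ᶜe rewrite insRow-bump {r = r} z<ᶜe | insRow-bump {r = r} y<ᶜz = pz , z<ᶜe
  ... | inj₂ e≤ʳz with <ᶜ-or-≤ʳ y e
  ...   | inj₁ y<ᶜe rewrite insRow-pass {r = r} e≤ʳz | insRow-bump {r = proj₁ (insRow S z r)} y<ᶜe =
    strict (insRow-bumped-above z r)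
    where
    strict : ∀ {m} → Maybe-All (z <ᶜ_) m → StrictlyBumped P m (just e)
    strict nothing = pe
    strict (just z<ᶜz′) = pe , ≤ʳ-<ᶜ⇒<ᶜ e≤ʳz z<ᶜz′
  ...   | inj₂ e≤ʳy rewrite insRow-pass {r = r} e≤ʳz | insRow-pass {r = proj₁ (insRow S z r)} e≤ʳy =
    row-bumping-<ᶜ r P (Linked.tail row) y<ᶜz pr pz

  knuth₂-compatible : ∀ r {x y z} → IsRow r → x <ᶜ y → y ≤ʳ z → KnuthCompatible r (y ∷ z ∷ x ∷ []) (y ∷ x ∷ z ∷ [])
  knuth₂-compatible [] _ x<ᶜy y≤ʳz = compatible-[] (knuth₂ x<ᶜy y≤ʳz)
  knuth₂-compatible (e ∷ r) {x} {y} {z} row x<ᶜy y≤ʳz with <ᶜ-or-≤ʳ y e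
  ... | inj₁ y<ᶜe =
    compatible (insRowWord-3 (e ∷ r) y z x (insRow-bump y<ᶜe) (insRow-pass y≤ʳz) (insRow-bump x<ᶜy))
               (insRowWord-3 (e ∷ r) y x z (insRow-bump y<ᶜe) (insRow-bump x<ᶜy) (insRow-pass x≤ʳz))
               refl (related (insRow-bumped-All z r (Linked⇒All-head ≤ʳ-trans row)))
    where
    x≤ʳz : x ≤ʳ z
    x≤ʳz = <ᶜ-≤ʳ⇒≤ʳ x<ᶜy y≤ʳz
    related : ∀ {m} → Maybe-All (e ≤ʳ_) m → KnuthOrEq (e ∷ m ?∷ [ y ]) (e ∷ y ∷ m ?∷ [])
    related nothing = inj₁ refl
    related (just e≤ʳz′) = inj₂ (inj₁ (knuth₂ y<ᶜe e≤ʳz′))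
  ... | inj₂ e≤ʳy with <ᶜ-or-≤ʳ x e
  ...   | inj₁ x<ᶜe =
    compatible (insRowWord-3 (e ∷ r) y z x (insRow-pass e≤ʳy) (insRow-pass (≤ʳ-trans e≤ʳy y≤ʳz)) (insRow-bump x<ᶜe))
               (insRowWord-3 (e ∷ r) y x z (insRow-pass e≤ʳy) (insRow-bump x<ᶜe) (insRow-pass x≤ʳz))
               refl (related (row-bumping-≤ʳ r (Linked.tail row) y≤ʳz) (insRow-bumped-above y r))
    where
    x≤ʳz : x ≤ʳ z
    x≤ʳz = <ᶜ-≤ʳ⇒≤ʳ x<ᶜy y≤ʳz
    related : ∀ {m₁ m₂} → WeaklyBumped m₁ m₂ → Maybe-All (y <ᶜ_) m₁ →
              KnuthOrEq (m₁ ?∷ m₂ ?∷ [ e ]) (m₁ ?∷ e ∷ m₂ ?∷ [])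
    related {nothing} {nothing} _ _ = inj₁ refl
    related {just _} {nothing} _ _ = inj₁ refl
    related {just y′} {just z′} y′≤ʳz′ (just y<ᶜy′) = inj₂ (inj₁ (knuth₂ (≤ʳ-<ᶜ⇒<ᶜ e≤ʳy y<ᶜy′) y′≤ʳz′))
  ...   | inj₂ e≤ʳx =
    compatible-pass e≤ʳy e≤ʳz e≤ʳx e≤ʳy e≤ʳx e≤ʳz (knuth₂-compatible r (Linked.tail row) x<ᶜy y≤ʳz)
    where
    e≤ʳz : e ≤ʳ z
    e≤ʳz = ≤ʳ-trans e≤ʳy y≤ʳz

  knuth₁-compatible : ∀ r {x y z} → IsRow r → x ≤ʳ y → y <ᶜ z → KnuthCompatible r (z ∷ x ∷ y ∷ []) (x ∷ z ∷ y ∷ [])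
  knuth₁-compatible [] _ x≤ʳy y<ᶜz = compatible-[] (knuth₁ x≤ʳy y<ᶜz)
  knuth₁-compatible (e ∷ r) {x} {y} {z} row x≤ʳy y<ᶜz with <ᶜ-or-≤ʳ x e
  ... | inj₂ e≤ʳx =
    compatible-pass e≤ʳz e≤ʳx e≤ʳy e≤ʳx e≤ʳz e≤ʳy (knuth₁-compatible r (Linked.tail row) x≤ʳy y<ᶜz)
    where
    e≤ʳy : e ≤ʳ y
    e≤ʳy = ≤ʳ-trans e≤ʳx x≤ʳy
    e≤ʳz : e ≤ʳ z
    e≤ʳz = ≤ʳ-<ᶜ⇒≤ʳ e≤ʳy y<ᶜz
  ... | inj₁ x<ᶜe with <ᶜ-or-≤ʳ z e
  ...   | inj₁ z<ᶜe =
    compatible (insRowWord-3 (e ∷ r) z x y (insRow-bump z<ᶜe) (insRow-bump (≤ʳ-<ᶜ⇒<ᶜ x≤ʳy y<ᶜz)) (insRow-pass x≤ʳy))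
               (insRowWord-3 (e ∷ r) x z y (insRow-bump x<ᶜe) (insRow-pass x≤ʳz) (insRow-pass x≤ʳy))
               (cong (x ∷_) (proj₁ (both-bump r (Linked⇒All-head ≤ʳ-trans row))))
               (proj₂ (both-bump r (Linked⇒All-head ≤ʳ-trans row)))
    where
    x≤ʳz : x ≤ʳ z
    x≤ʳz = ≤ʳ-<ᶜ⇒≤ʳ x≤ʳy y<ᶜz
    -- z and y, both column-below e ≤ʳ r, bump the first entry of r in turn.
    both-bump : ∀ r → All (e ≤ʳ_) r →
                proj₁ (insRow S y r) ≡ proj₁ (insRow S y (proj₁ (insRow S z r))) ×
                KnuthOrEq (e ∷ z ∷ proj₂ (insRow S y r) ?∷ [])
                          (e ∷ proj₂ (insRow S z r) ?∷ proj₂ (insRow S y (proj₁ (insRow S z r))) ?∷ [])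
    both-bump [] _ rewrite y<ᶜz = refl , inj₁ refl
    both-bump (g ∷ r′) (e≤ʳg ∷ _)
      rewrite insRow-bump {r = r′} (<ᶜ-trans y<ᶜz (<ᶜ-≤ʳ⇒<ᶜ z<ᶜe e≤ʳg)) | insRow-bump {r = r′} (<ᶜ-≤ʳ⇒<ᶜ z<ᶜe e≤ʳg)
            | insRow-bump {r = r′} y<ᶜz =
      refl , inj₂ (inj₂ (knuth₂ z<ᶜe e≤ʳg))
  ...   | inj₂ e≤ʳz =
    compatible (insRowWord-3 (e ∷ r) z x y (insRow-pass e≤ʳz) (insRow-bump x<ᶜe) (insRow-pass x≤ʳy))
               (insRowWord-3 (e ∷ r) x z y (insRow-bump x<ᶜe) (insRow-pass x≤ʳz) (insRow-pass x≤ʳy))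
               refl
               (related (proj₂ (insRow S z r)) (proj₂ (insRow S y (proj₁ (insRow S z r))))
                        (row-bumping-<ᶜ r (e ≤ʳ_) (Linked.tail row) y<ᶜz (Linked⇒All-head ≤ʳ-trans row) e≤ʳz))
    where
    x≤ʳz : x ≤ʳ z
    x≤ʳz = ≤ʳ-<ᶜ⇒≤ʳ x≤ʳy y<ᶜz
    related : ∀ m₁ m₂ → StrictlyBumped (e ≤ʳ_) m₁ m₂ → KnuthOrEq (m₁ ?∷ e ∷ m₂ ?∷ []) (e ∷ m₁ ?∷ m₂ ?∷ [])
    related nothing (just _) _ = inj₁ refl
    related (just z′) (just y′) (e≤ʳy′ , y′<ᶜz′) = inj₂ (inj₁ (knuth₁ e≤ʳy′ y′<ᶜz′))

  knuth-compatible : ∀ r {l l′} → IsRow r → Knuth l l′ → KnuthCompatible r l l′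
  knuth-compatible r row (knuth₁ x≤ʳy y<ᶜz) = knuth₁-compatible r row x≤ʳy y<ᶜz
  knuth-compatible r row (knuth₂ x<ᶜy y≤ʳz) = knuth₂-compatible r row x<ᶜy y≤ʳz

  insertWord-knuth : ∀ T {l l′} → All IsRow T → Knuth l l′ → insertWord T l ≡ insertWord T l′
  -- On nonempty words, insertion into [] and into [ [] ] agree definitionally.
  insertWord-knuth [] _ k@(knuth₁ _ _) = insertWord-knuth-[] k
  insertWord-knuth [] _ k@(knuth₂ _ _) = insertWord-knuth-[] k
  insertWord-knuth (r ∷ T) {l} {l′} (row ∷ rows) k with knuth-compatible r row k
  ... | same , related = trans (insertWord-∷ r T l) (trans (cong₂ _∷_ same (bumped related)) (sym (insertWord-∷ r T l′)))
    where
    bumped : ∀ {w w′} → KnuthOrEq w w′ → insertWord T w ≡ insertWord T w′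
    bumped (inj₁ refl) = refl
    bumped (inj₂ (inj₁ k′)) = insertWord-knuth T rows k′
    bumped (inj₂ (inj₂ k′)) = sym (insertWord-knuth T rows k′)

  -- The plactic congruence and the row reading

  infix 4 _≈_
  _≈_ : List Carrier → List Carrier → Set
  _≈_ = _≈P_ S

  insertWord-≈ : ∀ T → All IsRow T → ∀ {a b} → a ≈ b → insertWord T a ≡ insertWord T b
  insertWord-≈ T rows = Eq.gfold isEquivalence (insertWord T) insertWord-pstep
    where
    insertWord-pstep : ∀ {a b} → PStep S a b → insertWord T a ≡ insertWord T b
    insertWord-pstep (pstep x y {l} {r} rel) = begin
      insertWord T (x ++ l ++ y)                 ≡⟨ insertWord-++ T x (l ++ y) ⟩
      insertWord (insertWord T x) (l ++ y)       ≡⟨ insertWord-++ (insertWord T x) l y ⟩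
      insertWord (insertWord (insertWord T x) l) y
        ≡⟨ cong (flip insertWord y) (insertWord-knuth (insertWord T x) (insertWord-rows T x rows) (PRel⇒Knuth rel)) ⟩
      insertWord (insertWord (insertWord T x) r) y ≡⟨ insertWord-++ (insertWord T x) r y ⟨
      insertWord (insertWord T x) (r ++ y)       ≡⟨ insertWord-++ T x (r ++ y) ⟨
      insertWord T (x ++ r ++ y)                 ∎
      where open ≡-Reasoning

  ≡⇒≈ : ∀ {a b} → a ≡ b → a ≈ b
  ≡⇒≈ refl = ε

  ≈-sym : ∀ {a b} → a ≈ b → b ≈ a
  ≈-sym = Eq.symmetric (PStep S)

  ≈-trans : ∀ {a b c} → a ≈ b → b ≈ c → a ≈ c
  ≈-trans = _◅◅_

  ≈-context : ∀ p q {a b} → a ≈ b → p ++ a ++ q ≈ p ++ b ++ q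
  ≈-context p q = Eq.gmap (λ w → p ++ w ++ q) pstep-context
    where
    reassoc : ∀ x m y → (p ++ x) ++ m ++ y ++ q ≡ p ++ (x ++ m ++ y) ++ q
    reassoc x m y = begin
      (p ++ x) ++ m ++ y ++ q   ≡⟨ ++-assoc p x (m ++ y ++ q) ⟩
      p ++ x ++ m ++ y ++ q     ≡⟨ cong (λ z → p ++ x ++ z) (++-assoc m y q) ⟨
      p ++ x ++ (m ++ y) ++ q   ≡⟨ cong (p ++_) (++-assoc x (m ++ y) q) ⟨
      p ++ (x ++ m ++ y) ++ q   ∎
      where open ≡-Reasoning
    pstep-context : ∀ {a b} → PStep S a b → PStep S (p ++ a ++ q) (p ++ b ++ q)
    pstep-context (pstep x y {l} {r} rel) = subst₂ (PStep S) (reassoc x l y) (reassoc x r y) (pstep (p ++ x) (y ++ q) rel)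

  ≈-contextˡ : ∀ p {a b} → a ≈ b → p ++ a ≈ p ++ b
  ≈-contextˡ p {a} {b} a≈b =
    subst₂ _≈_ (cong (p ++_) (++-identityʳ a)) (cong (p ++_) (++-identityʳ b)) (≈-context p [] a≈b)

  ≈-contextʳ : ∀ q {a b} → a ≈ b → a ++ q ≈ b ++ q
  ≈-contextʳ q = ≈-context [] q

  knuth-≈ : ∀ {l r} q → Knuth l r → l ++ q ≈ r ++ q
  knuth-≈ q k = fwd (pstep [] q (Knuth⇒PRel k)) ◅ ε

  move-after-first : ∀ {x e} r → IsRow (e ∷ r) → x <ᶜ e → e ∷ r ++ [ x ] ≈ e ∷ x ∷ r
  move-after-first [] _ _ = ε
  move-after-first {x} {e} (c ∷ r) (e≤ʳc ∷ row) x<ᶜe =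
    ≈-trans (≈-contextˡ [ e ] (move-after-first r row (<ᶜ-≤ʳ⇒<ᶜ x<ᶜe e≤ʳc))) (knuth-≈ r (knuth₂ x<ᶜe e≤ʳc))

  insRow-≈ : ∀ x r {r′ y} → IsRow r → insRow S x r ≡ (r′ , just y) → r ++ [ x ] ≈ y ∷ r′
  insRow-≈ x (e ∷ r) row eq with <ᶜ-or-≤ʳ x e
  ... | inj₁ x<ᶜe with trans (sym (insRow-bump {r = r} x<ᶜe)) eq
  ...   | refl = move-after-first r row x<ᶜe
  insRow-≈ x (e ∷ r) {y = y} row eq | inj₂ e≤ʳx with ,-injective (trans (sym (insRow-pass {r = r} e≤ʳx)) eq)
  ...   | refl , m≡ with insRow-just-head x r (cong (proj₁ (insRow S x r) ,_) m≡)
  ...     | t , rest , r₁≡ , t<ᶜy , from-r∷x rewrite r₁≡ =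
    ≈-trans (≈-contextˡ [ e ] (insRow-≈ x r (Linked.tail row) (cong₂ _,_ r₁≡ m≡)))
            (≈-sym (knuth-≈ rest (knuth₁ (from-r∷x (e ≤ʳ_) (Linked⇒All-head ≤ʳ-trans row) e≤ʳx) t<ᶜy)))

  reading : Tableau S → List Carrier
  reading [] = []
  reading (r ∷ T) = reading T ++ r

  reading-insert : ∀ T x → All IsRow T → reading T ++ [ x ] ≈ reading (insert S T x)
  reading-insert [] x _ = ε
  reading-insert (r ∷ T) x (row ∷ rows) with insRow S x r in eq
  ... | r′ , nothing = ≡⇒≈ (trans (++-assoc (reading T) r [ x ]) (cong (reading T ++_) (sym (insRow-nothing x r eq))))
  ... | r′ , just y =
    ≈-trans (≡⇒≈ (++-assoc (reading T) r [ x ]))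
      (≈-trans (≈-contextˡ (reading T) (insRow-≈ x r row eq))
        (≈-trans (≡⇒≈ (sym (++-assoc (reading T) [ y ] r′))) (≈-contextʳ r′ (reading-insert T y rows))))

  reading-insertWord : ∀ T w → All IsRow T → reading T ++ w ≈ reading (insertWord T w)
  reading-insertWord T [] _ = ≡⇒≈ (++-identityʳ _)
  reading-insertWord T (x ∷ w) rows =
    ≈-trans (≡⇒≈ (sym (++-assoc (reading T) [ x ] w)))
      (≈-trans (≈-contextʳ w (reading-insert T x rows)) (reading-insertWord (insert S T x) w (insert-rows T x rows)))

  rect-≡⇒≈ : ∀ a b → rect S a ≡ rect S b → a ≈ b
  rect-≡⇒≈ a b eq =
    ≈-trans (reading-insertWord [] a []) (≈-trans (≡⇒≈ (cong reading eq)) (≈-sym (reading-insertWord [] b [])))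

  colB≡bumps : ∀ a b → colB S a b ≡ bumps S a b
  colB≡bumps a b with parity a
  ... | true  = cong (⌊ a <? b ⌋ ∨_) (∧-identityʳ _)
  ... | false = trans (cong (⌊ a <? b ⌋ ∨_) (∧-zeroʳ _)) (∨-identityʳ _)

  superColumn?⇒Linked : ∀ w → T (superColumn? S w) → Linked (flip _<ᶜ_) w
  superColumn?⇒Linked [] _ = []
  superColumn?⇒Linked (x ∷ []) _ = [-]
  superColumn?⇒Linked (x ∷ y ∷ w) t =
    trans (sym (colB≡bumps y x)) (Equivalence.to T-≡ (proj₁ (Equivalence.to T-∧ t)))
    ∷ superColumn?⇒Linked (y ∷ w) (proj₂ (Equivalence.to T-∧ t))

  Linked⇒superColumn? : ∀ w → Linked (flip _<ᶜ_) w → T (superColumn? S w)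
  Linked⇒superColumn? [] _ = tt
  Linked⇒superColumn? (x ∷ []) _ = tt
  Linked⇒superColumn? (x ∷ y ∷ w) (y<ᶜx ∷ rest) =
    Equivalence.from T-∧ (Equivalence.from T-≡ (trans (colB≡bumps y x) y<ᶜx) , Linked⇒superColumn? (y ∷ w) rest)

  -- The entries of a generator c_u, read top to bottom.
  column : Col S → List Carrier
  column u = reverse (word S u)

  column-isColumn : ∀ u → IsColumn (column u)
  column-isColumn (w , t) = Linked-reverse <ᶜ-trans (superColumn?⇒Linked w (proj₂ (Equivalence.to T-∧ t)))

  column-nonempty : ∀ u → ∃₂ λ a U → column u ≡ a ∷ U
  column-nonempty (x ∷ w , _) with reverse w | unfold-reverse x w
  ... | [] | eq = x , [] , eq
  ... | a ∷ U | eq = a , U ++ [ x ] , eq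

  length-column : ∀ u → length (column u) ≡ length (word S u)
  length-column u = length-reverse (word S u)

  word-nonempty : ∀ u → 0 <ℕ length (word S u)
  word-nonempty u with column-nonempty u
  ... | a , U , eq = subst (0 <ℕ_) (trans (cong length (sym eq)) (length-column u)) (s≤s z≤n)

  reverse-column-isSuperColumn : ∀ c C → IsColumn (c ∷ C) → T (nonemptySuperColumn? S (reverse (c ∷ C)))
  reverse-column-isSuperColumn c C col =
    Equivalence.from T-∧ (nonnull , Linked⇒superColumn? (reverse (c ∷ C)) flipped)
    where
    flipped : Linked (flip _<ᶜ_) (reverse (c ∷ C))
    flipped = Linked-reverse (flip <ᶜ-trans) col
    nonnull : T (not (null (reverse (c ∷ C))))
    nonnull rewrite unfold-reverse c C with reverse C
    ... | [] = tt
    ... | _ ∷ _ = tt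

  column-injective : ∀ {u v} → column u ≡ column v → u ≡ v
  column-injective {w , t} {w′ , t′} eq with reverse-injective {x = w} {y = w′} eq
  ... | refl = cong (w ,_) (T-irrelevant t t′)

  rect-generator : ∀ u → rect S (word S u) ≡ map [_] (column u)
  rect-generator u = trans (cong (insertWord []) (sym (reverse-involutive (word S u)))) (rect-column (column u) (column-isColumn u))

  juxt-columns : ∀ U V → Juxtaposable U V → juxtW S 1 (map [_] U) (map [_] V) ≡ just (twoColumns U V)
  juxt-columns U [] _ = cong just (twoColumns-[] U)
  juxt-columns (u ∷ U) (v ∷ V) (_ , jux) rewrite juxt-columns U V jux = refl

  twoColumns-rows : ∀ U V → Juxtaposable U V → All (λ r → NonEmpty S r × Linked (RowRel S) r) (twoColumns U V)
  twoColumns-rows [] _ _ = []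
  twoColumns-rows (u ∷ U) [] _ = (tt , [-]) ∷ twoColumns-rows U [] tt
  twoColumns-rows (u ∷ U) (v ∷ V) (u≤ʳv , jux) = (tt , ≤ʳ⇒RowRel u≤ʳv ∷ [-]) ∷ twoColumns-rows U V jux

  twoColumns-below : ∀ U V → IsColumn U → IsColumn V → Juxtaposable U V → Linked (Below S) (twoColumns U V)
  twoColumns-below [] _ _ _ _ = []
  twoColumns-below (u ∷ []) [] _ _ _ = [-]
  twoColumns-below (u ∷ []) (v ∷ []) _ _ _ = [-]
  twoColumns-below (u ∷ []) (v ∷ _ ∷ _) _ _ (_ , ())
  twoColumns-below (u ∷ u₂ ∷ U) [] (u<ᶜu₂ ∷ colU) _ _ =
    (<ᶜ⇒ColRel u<ᶜu₂ , tt) ∷ twoColumns-below (u₂ ∷ U) [] colU [] tt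
  twoColumns-below (u ∷ u₂ ∷ U) (v ∷ []) (u<ᶜu₂ ∷ colU) _ _ =
    (<ᶜ⇒ColRel u<ᶜu₂ , tt) ∷ twoColumns-below (u₂ ∷ U) [] colU [] tt
  twoColumns-below (u ∷ u₂ ∷ U) (v ∷ v₂ ∷ V) (u<ᶜu₂ ∷ colU) (v<ᶜv₂ ∷ colV) (_ , jux) =
    (<ᶜ⇒ColRel u<ᶜu₂ , <ᶜ⇒ColRel v<ᶜv₂ , tt) ∷ twoColumns-below (u₂ ∷ U) (v₂ ∷ V) colU colV jux

  clash⇒¬superTableau : ∀ U V → Clash U V → ∀ t → juxtW S 1 (map [_] U) (map [_] V) ≡ just t → ¬ IsSuperTableau S t
  clash⇒¬superTableau (u ∷ U) (v ∷ V) clash t eq st with juxtW S 1 (map [_] U) (map [_] V) in eq′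
  ... | just t′ with refl ← eq with clash | st
  ...   | inj₁ v<ᶜu | ((_ , u≤v ∷ _) ∷ _) , _ = <ᶜ⇒≱ʳ v<ᶜu (RowRel⇒≤ʳ u≤v)
  ...   | inj₂ clash′ | (_ ∷ rows) , below = clash⇒¬superTableau U V clash′ t′ eq′ (rows , Linked.tail below)

  FormsTableau : Col S → Col S → Set
  FormsTableau u v = FormsSuperTableau S (rect S (word S u)) (rect S (word S v))

  juxt-generators : ∀ u v → juxt S (rect S (word S u)) (rect S (word S v)) ≡ juxtW S 1 (map [_] (column u)) (map [_] (column v))
  juxt-generators u v rewrite rect-generator u | rect-generator v with column-nonempty u
  ... | a , U , eq rewrite eq = refl

  ¬FormsTableau⇒clash : ∀ u v → ¬ FormsTableau u v → Clash (column u) (column v)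
  ¬FormsTableau⇒clash u v ¬forms with juxtaposable-or-clash (column u) (column v)
  ... | inj₂ clash = clash
  ... | inj₁ jux = ⊥-elim (¬forms (twoColumns (column u) (column v) ,
                                  trans (juxt-generators u v) (juxt-columns (column u) (column v) jux) ,
                                  twoColumns-rows (column u) (column v) jux ,
                                  twoColumns-below (column u) (column v) (column-isColumn u) (column-isColumn v) jux))

  clash⇒¬FormsTableau : ∀ u v → Clash (column u) (column v) → ¬ FormsTableau u v
  clash⇒¬FormsTableau u v clash (t , eq , st) =
    clash⇒¬superTableau (column u) (column v) clash t (trans (sym (juxt-generators u v)) eq) st

  readingCol-twoColumns-0 : ∀ C D → readingCol S 0 (twoColumns C D) ≡ reverse C
  readingCol-twoColumns-0 C D = cong reverse (firsts C D)
    where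
    firsts : ∀ C D → mapMaybe (λ r → nth S r 0) (twoColumns C D) ≡ C
    firsts [] _ = refl
    firsts (c ∷ C) [] = cong (c ∷_) (firsts C [])
    firsts (c ∷ C) (d ∷ D) = cong (c ∷_) (firsts C D)

  readingCol-twoColumns-1 : ∀ C D → Juxtaposable C D → readingCol S 1 (twoColumns C D) ≡ reverse D
  readingCol-twoColumns-1 C D jux = cong reverse (seconds C D jux)
    where
    seconds : ∀ C D → Juxtaposable C D → mapMaybe (λ r → nth S r 1) (twoColumns C D) ≡ D
    seconds [] [] _ = refl
    seconds (c ∷ C) [] _ = seconds C [] tt
    seconds (c ∷ C) (d ∷ D) (_ , jux) = cong (d ∷_) (seconds C D jux)

  rect-two-generators : ∀ u v → rect S (word S u ++ word S v) ≡ insColumn (column u) (column v)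
  rect-two-generators u v = begin
    rect S (word S u ++ word S v)                      ≡⟨ insertWord-++ [] (word S u) (word S v) ⟩
    insertWord (rect S (word S u)) (word S v)           ≡⟨ cong (flip insertWord (word S v)) (rect-generator u) ⟩
    insertWord (map [_] (column u)) (word S v)          ≡⟨ cong (insertWord (map [_] (column u))) (reverse-involutive (word S v)) ⟨
    insertWord (map [_] (column u)) (reverse (column v)) ≡⟨ insertWord-column (column u) (column v) (column-isColumn u) (column-isColumn v) ⟩
    insColumn (column u) (column v)                     ∎
    where open ≡-Reasoning

  rect-twoColumns : ∀ C D → IsColumn C → IsColumn D → Juxtaposable C D → rect S (reverse C ++ reverse D) ≡ twoColumns C D
  rect-twoColumns C D colC colD jux = begin
    rect S (reverse C ++ reverse D)                ≡⟨ insertWord-++ [] (reverse C) (reverse D) ⟩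
    insertWord (rect S (reverse C)) (reverse D)    ≡⟨ cong (flip insertWord (reverse D)) (rect-column C colC) ⟩
    insertWord (map [_] C) (reverse D)             ≡⟨ insertWord-column C D colC colD ⟩
    insColumn C D                                  ≡⟨ tableau ⟩
    twoColumns left right                          ≡⟨ cong₂ twoColumns left≡C right≡D ⟩
    twoColumns C D                                 ∎
    where
    open ≡-Reasoning
    open InsColumn (insColumn-spec C D colC colD)
    left≡C : left ≡ C
    left≡C = proj₁ (same-if-juxtaposable jux)
    right≡D : right ≡ D
    right≡D = proj₂ (same-if-juxtaposable jux)

  -- The rules preserve the tableau and terminate

  letters : List (Col S) → List Carrier
  letters = concatMap (word S)

  letters-++ : ∀ s t → letters (s ++ t) ≡ letters s ++ letters t
  letters-++ s t = trans (cong concat (map-++ (word S) s t)) (sym (concat-++ (map (word S) s) (map (word S) t)))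

  size : List (Col S) → ℕ
  size s = length (letters s)

  size-++ : ∀ s t → size (s ++ t) ≡ size s + size t
  size-++ s t = trans (cong length (letters-++ s t)) (length-++ (letters s))

  -- Each letter counts once for every generator to its left; rules move letters leftwards.
  weight : List (Col S) → ℕ
  weight [] = 0
  weight (u ∷ s) = weight s + size s

  record RuleEffect (l r : List (Col S)) : Set where
    field
      same-rect      : rect S (letters l) ≡ rect S (letters r)
      same-size      : size l ≡ size r
      weight-decreases : ∀ y → weight (r ++ y) <ℕ weight (l ++ y)

  module TwoColumnRule (u v w w′ : Col S) (¬forms : ¬ FormsTableau u v)
                       (w≡ : word S w ≡ readingCol S 0 (rect S (word S u ++ word S v)))
                       (w′≡ : word S w′ ≡ readingCol S 1 (rect S (word S u ++ word S v))) where
    open InsColumn (insColumn-spec (column u) (column v) (column-isColumn u) (column-isColumn v))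
    open ≡-Reasoning

    rect-uv : rect S (word S u ++ word S v) ≡ twoColumns left right
    rect-uv = trans (rect-two-generators u v) tableau

    w≡left : word S w ≡ reverse left
    w≡left = trans w≡ (trans (cong (readingCol S 0) rect-uv) (readingCol-twoColumns-0 left right))

    w′≡right : word S w′ ≡ reverse right
    w′≡right = trans w′≡ (trans (cong (readingCol S 1) rect-uv) (readingCol-twoColumns-1 left right juxtaposable))

    same-rect : rect S (word S u ++ word S v) ≡ rect S (word S w ++ word S w′)
    same-rect = begin
      rect S (word S u ++ word S v)          ≡⟨ rect-uv ⟩
      twoColumns left right                  ≡⟨ rect-twoColumns left right left-column right-column juxtaposable ⟨
      rect S (reverse left ++ reverse right) ≡⟨ cong₂ (λ a b → rect S (a ++ b)) w≡left w′≡right ⟨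
      rect S (word S w ++ word S w′)         ∎

    sizes : length (word S w) + length (word S w′) ≡ length (word S u) + length (word S v)
    sizes = begin
      length (word S w) + length (word S w′)           ≡⟨ cong₂ _+_ (cong length w≡left) (cong length w′≡right) ⟩
      length (reverse left) + length (reverse right)   ≡⟨ cong₂ _+_ (length-reverse left) (length-reverse right) ⟩
      length left + length right                       ≡⟨ total-size ⟩
      length (column u) + length (column v)            ≡⟨ cong₂ _+_ (length-column u) (length-column v) ⟩
      length (word S u) + length (word S v)            ∎

    -- The clash forces the left column to grow, so the right one must shrink.
    shorter : length (word S w′) <ℕ length (word S v)
    shorter = summand-< (subst₂ _<ℕ_ (length-column u) (trans (sym (length-reverse left)) (cong length (sym w≡left)))
                                    (longer-if-clash (¬FormsTableau⇒clash u v ¬forms)))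
                        sizes

  rule-effect : ∀ {l r} → Rule S l r → RuleEffect l r
  rule-effect (γ-one u v w _ _ w≡uv) = record
    { same-rect = cong (rect S) same-letters
    ; same-size = cong length same-letters
    ; weight-decreases = λ y →
        let n = weight y + size y in
        subst (λ k → n <ℕ n + k) (sym (length-++ (word S v)))
          (m<m+n n (<-≤-trans (word-nonempty v) (m≤m+n _ _)))
    }
    where
    same-letters : word S u ++ word S v ++ [] ≡ word S w ++ []
    same-letters = trans (cong (word S u ++_) (++-identityʳ _)) (trans (sym w≡uv) (sym (++-identityʳ _)))
  rule-effect (γ-two u v w w′ ¬forms _ w≡ w′≡) = record
    { same-rect = subst₂ (λ a b → rect S (word S u ++ a) ≡ rect S (word S w ++ b)) (sym (++-identityʳ _)) (sym (++-identityʳ _))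
                         same-rect
    ; same-size = subst₂ (λ a b → length (word S u ++ a) ≡ length (word S w ++ b)) (sym (++-identityʳ _)) (sym (++-identityʳ _))
                         (trans (length-++ (word S u)) (trans (sym sizes) (sym (length-++ (word S w)))))
    ; weight-decreases = λ y →
        +-monoʳ-< (weight y + size y)
          (subst₂ _<ℕ_ (sym (length-++ (word S w′))) (sym (length-++ (word S v))) (+-monoˡ-< (size y) shorter))
    }
    where open TwoColumnRule u v w w′ ¬forms w≡ w′≡

  letters-++₃ : ∀ x l y → letters (x ++ l ++ y) ≡ letters x ++ letters l ++ letters y
  letters-++₃ x l y = trans (letters-++ x (l ++ y)) (cong (letters x ++_) (letters-++ l y))

  step-≈ : ∀ {a b} → Step S a b → letters a ≈ letters b
  step-≈ (step x y {l} {r} rule) =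
    subst₂ _≈_ (sym (letters-++₃ x l y)) (sym (letters-++₃ x r y))
      (≈-context (letters x) (letters y) (rect-≡⇒≈ (letters l) (letters r) (RuleEffect.same-rect (rule-effect rule))))

  ≈-rect : ∀ {a b} → a ≈ b → rect S a ≡ rect S b
  ≈-rect = insertWord-≈ [] []

  steps-rect : ∀ {a b} → Star (Step S) a b → rect S (letters a) ≡ rect S (letters b)
  steps-rect ε = refl
  steps-rect (s ◅ ss) = trans (≈-rect (step-≈ s)) (steps-rect ss)

  weight-prefix : ∀ x {A B} → size A ≡ size B → weight A <ℕ weight B → weight (x ++ A) <ℕ weight (x ++ B)
  weight-prefix [] _ lt = lt
  weight-prefix (u ∷ x) {A} {B} same lt =
    +-mono-<-≤ (weight-prefix x same lt)
      (≤-reflexive (trans (size-++ x A) (trans (cong (size x +_) same) (sym (size-++ x B)))))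

  step-weight : ∀ {a b} → Step S a b → weight b <ℕ weight a
  step-weight (step x y {l} {r} rule) =
    weight-prefix x (trans (size-++ r y) (trans (cong (_+ size y) (sym same-size)) (sym (size-++ l y)))) (weight-decreases y)
    where open RuleEffect (rule-effect rule)

  terminating : Terminating S
  terminating = Subrelation.wellFounded step-weight (On.wellFounded weight <-wellFounded)

  -- Normal forms

  Normal : List (Col S) → Set
  Normal = Linked (λ u v → Juxtaposable (column u) (column v))

  record Reducible (s : List (Col S)) : Set where
    constructor redex
    field
      prefix : List (Col S)
      u v : Col S
      suffix : List (Col S)
      splits : s ≡ prefix ++ u ∷ v ∷ suffix
      clash : Clash (column u) (column v)

  normal-or-reducible : ∀ s → Normal s ⊎ Reducible s
  normal-or-reducible [] = inj₁ []
  normal-or-reducible (u ∷ []) = inj₁ [-]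
  normal-or-reducible (u ∷ v ∷ s) with juxtaposable-or-clash (column u) (column v) | normal-or-reducible (v ∷ s)
  ... | inj₂ clash | _ = inj₂ (redex [] u v s refl clash)
  ... | inj₁ jux | inj₁ normal = inj₁ (jux ∷ normal)
  ... | inj₁ _ | inj₂ (redex x u′ v′ y splits clash) = inj₂ (redex (u ∷ x) u′ v′ y (cong (u ∷_) splits) clash)

  reduce : ∀ u v → Clash (column u) (column v) → ∃ (Rule S (u ∷ v ∷ []))
  reduce u v clash =
    reduce′ left right (trans (rect-two-generators u v) tableau) left-column right-column juxtaposable
            (longer-if-clash clash) one-column
    where
    open InsColumn (insColumn-spec (column u) (column v) (column-isColumn u) (column-isColumn v))
    ¬forms : ¬ FormsTableau u v
    ¬forms = clash⇒¬FormsTableau u v clash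
    reduce′ : ∀ C D → rect S (word S u ++ word S v) ≡ twoColumns C D → IsColumn C → IsColumn D → Juxtaposable C D →
              length (column u) <ℕ length C → (D ≡ [] → C ≡ column v ++ column u) → ∃ (Rule S (u ∷ v ∷ []))
    reduce′ (c ∷ C) [] rect≡ colC _ _ _ one-col =
      (w ∷ []) , γ-one u v w ¬forms (cong (width S) rect≡) refl
      where
      w≡ : reverse (c ∷ C) ≡ word S u ++ word S v
      w≡ = trans (cong reverse (one-col refl)) (trans (reverse-++ (column v) (column u))
                   (cong₂ _++_ (reverse-involutive (word S u)) (reverse-involutive (word S v))))
      w : Col S
      w = word S u ++ word S v , subst (T ∘ nonemptySuperColumn? S) w≡ (reverse-column-isSuperColumn c C colC)
    reduce′ (c ∷ C) (d ∷ D) rect≡ colC colD jux _ _ =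
      (w ∷ w′ ∷ []) , γ-two u v w w′ ¬forms (cong (width S) rect≡) refl refl
      where
      w : Col S
      w = readingCol S 0 (rect S (word S u ++ word S v)) ,
          subst (T ∘ nonemptySuperColumn? S) (sym (trans (cong (readingCol S 0) rect≡) (readingCol-twoColumns-0 (c ∷ C) (d ∷ D))))
            (reverse-column-isSuperColumn c C colC)
      w′ : Col S
      w′ = readingCol S 1 (rect S (word S u ++ word S v)) ,
           subst (T ∘ nonemptySuperColumn? S) (sym (trans (cong (readingCol S 1) rect≡) (readingCol-twoColumns-1 (c ∷ C) (d ∷ D) jux)))
             (reverse-column-isSuperColumn d D colD)

  normalise : ∀ s → ∃ λ n → Star (Step S) s n × Normal n
  normalise s = go s (terminating s)
    where
    go : ∀ s → Acc (flip (Step S)) s → ∃ λ n → Star (Step S) s n × Normal n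
    go s (acc smaller) with normal-or-reducible s
    ... | inj₁ normal = s , ε , normal
    ... | inj₂ (redex x u v y refl clash) with reduce u v clash
    ...   | r , rule with go (x ++ r ++ y) (smaller (step x y rule))
    ...     | n , steps , normal = n , step x y rule ◅ steps , normal

  appendColumn : List Carrier → Tableau S → Tableau S
  appendColumn [] T = T
  appendColumn (k ∷ K) [] = [ k ] ∷ appendColumn K []
  appendColumn (k ∷ K) (r ∷ T) = (r ∷ʳ k) ∷ appendColumn K T

  appendColumns : Tableau S → List (List Carrier) → Tableau S
  appendColumns T [] = T
  appendColumns T (K ∷ Ks) = appendColumns (appendColumn K T) Ks

  Fits : Tableau S → List Carrier → Set
  Fits _ [] = ⊤
  Fits [] (_ ∷ _) = ⊤
  Fits (r ∷ T) (k ∷ K) = All (_≤ʳ k) r × Fits T K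

  insRowWord-column : ∀ r k K → All (_≤ʳ k) r → IsColumn (k ∷ K) → insRowWord r (reverse (k ∷ K)) ≡ (r ∷ʳ k , reverse K)
  insRowWord-column r k [] r≤ʳk _ rewrite insRow-append r r≤ʳk = refl
  insRowWord-column r k (k₂ ∷ K) r≤ʳk (k<ᶜk₂ ∷ col)
    rewrite unfold-reverse k (k₂ ∷ K) | insRowWord-∷ʳ r (reverse (k₂ ∷ K)) k
          | insRowWord-column r k₂ K (All.map (λ e≤ʳk → (≤ʳ-<ᶜ⇒≤ʳ e≤ʳk k<ᶜk₂)) r≤ʳk) col
          | insRow-middle r [] r≤ʳk k<ᶜk₂ =
    cong (r ∷ʳ k ,_) (sym (unfold-reverse k₂ K))

  insertWord-appendColumn : ∀ K T → IsColumn K → Fits T K → insertWord T (reverse K) ≡ appendColumn K T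
  insertWord-appendColumn [] T _ _ = refl
  insertWord-appendColumn (k ∷ K) [] col _ = trans (rect-column (k ∷ K) col) (appended (k ∷ K))
    where
    appended : ∀ K → map [_] K ≡ appendColumn K []
    appended [] = refl
    appended (k ∷ K) = cong ([ k ] ∷_) (appended K)
  insertWord-appendColumn (k ∷ K) (r ∷ T) col (r≤ʳk , fits)
    rewrite insertWord-∷ r T (reverse (k ∷ K)) | insRowWord-column r k K r≤ʳk col =
    cong ((r ∷ʳ k) ∷_) (insertWord-appendColumn K T (Linked.tail col) fits)

  Fits-[] : ∀ K → Fits [] K
  Fits-[] [] = tt
  Fits-[] (_ ∷ _) = tt

  Fits-appendColumn : ∀ T K K′ → Fits T K → Juxtaposable K K′ → Fits (appendColumn K T) K′
  Fits-appendColumn T K [] _ _ = tt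
  Fits-appendColumn [] (k ∷ K) (k′ ∷ K′) _ (k≤ʳk′ , jux) = (k≤ʳk′ ∷ []) , Fits-appendColumn [] K K′ (Fits-[] K) jux
  Fits-appendColumn (r ∷ T) (k ∷ K) (k′ ∷ K′) (r≤ʳk , fits) (k≤ʳk′ , jux) =
    ∷ʳ⁺ (All.map (λ e≤ʳk → ≤ʳ-trans e≤ʳk k≤ʳk′) r≤ʳk) k≤ʳk′ , Fits-appendColumn T K K′ fits jux

  insertWord-normal : ∀ T u s → Normal (u ∷ s) → Fits T (column u) →
                      insertWord T (letters (u ∷ s)) ≡ appendColumns T (map column (u ∷ s))
  insertWord-normal T u s normal fits = begin
    insertWord T (word S u ++ letters s)                   ≡⟨ insertWord-++ T (word S u) (letters s) ⟩
    insertWord (insertWord T (word S u)) (letters s)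
      ≡⟨ cong (λ w → insertWord (insertWord T w) (letters s)) (sym (reverse-involutive (word S u))) ⟩
    insertWord (insertWord T (reverse (column u))) (letters s)
      ≡⟨ cong (flip insertWord (letters s)) (insertWord-appendColumn (column u) T (column-isColumn u) fits) ⟩
    insertWord (appendColumn (column u) T) (letters s)     ≡⟨ rest s normal ⟩
    appendColumns (appendColumn (column u) T) (map column s) ∎
    where
    open ≡-Reasoning
    rest : ∀ s → Normal (u ∷ s) →
           insertWord (appendColumn (column u) T) (letters s) ≡ appendColumns (appendColumn (column u) T) (map column s)
    rest [] _ = refl
    rest (v ∷ s) (jux ∷ normal) =
      insertWord-normal (appendColumn (column u) T) v s normal (Fits-appendColumn T (column u) (column v) fits jux)

  prependColumn : List Carrier → Tableau S → Tableau S
  prependColumn [] T = T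
  prependColumn (p ∷ P) [] = [ p ] ∷ prependColumn P []
  prependColumn (p ∷ P) (r ∷ T) = (p ∷ r) ∷ prependColumn P T

  fromColumns : List (List Carrier) → Tableau S
  fromColumns [] = []
  fromColumns (K ∷ Ks) = prependColumn K (fromColumns Ks)

  Decreasing : List (List Carrier) → Set
  Decreasing = Linked (λ K K′ → length K′ ≤ℕ length K)

  length-prependColumn : ∀ P T → length T ≤ℕ length P → length (prependColumn P T) ≡ length P
  length-prependColumn [] [] _ = refl
  length-prependColumn (p ∷ P) [] _ = cong suc (length-prependColumn P [] z≤n)
  length-prependColumn (p ∷ P) (r ∷ T) (s≤s T≤P) = cong suc (length-prependColumn P T T≤P)

  length-fromColumns : ∀ K Ks → Decreasing (K ∷ Ks) → length (fromColumns Ks) ≤ℕ length K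
  length-fromColumns K [] _ = z≤n
  length-fromColumns K (K′ ∷ Ks) (K′≤K ∷ dec) =
    subst (_≤ℕ length K) (sym (length-prependColumn K′ (fromColumns Ks) (length-fromColumns K′ Ks dec))) K′≤K

  appendColumn-prependColumn : ∀ P T K → length K ≤ℕ length P → length T ≤ℕ length P →
                               appendColumn K (prependColumn P T) ≡ prependColumn P (appendColumn K T)
  appendColumn-prependColumn [] [] [] _ _ = refl
  appendColumn-prependColumn (p ∷ P) T [] _ _ = refl
  appendColumn-prependColumn (p ∷ P) [] (k ∷ K) (s≤s K≤P) _ =
    cong ((p ∷ k ∷ []) ∷_) (appendColumn-prependColumn P [] K K≤P z≤n)
  appendColumn-prependColumn (p ∷ P) (r ∷ T) (k ∷ K) (s≤s K≤P) (s≤s T≤P) =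
    cong ((p ∷ r ∷ʳ k) ∷_) (appendColumn-prependColumn P T K K≤P T≤P)

  appendColumn-fromColumns : ∀ Ks K → Decreasing (Ks ∷ʳ K) → appendColumn K (fromColumns Ks) ≡ fromColumns (Ks ∷ʳ K)
  appendColumn-fromColumns [] K _ = sym (prepended K)
    where
    prepended : ∀ K → prependColumn K [] ≡ appendColumn K []
    prepended [] = refl
    prepended (k ∷ K) = cong ([ k ] ∷_) (prepended K)
  appendColumn-fromColumns (P ∷ Ps) K dec =
    trans (appendColumn-prependColumn P (fromColumns Ps) K K≤P (length-fromColumns P Ps (Linked-++⁻ˡ (P ∷ Ps) dec)))
          (cong (prependColumn P) (appendColumn-fromColumns Ps K (Linked.tail dec)))
    where
    K≤P : length K ≤ℕ length P
    K≤P = proj₂ (∷ʳ⁻ (Linked⇒All-head (λ b≤a c≤b → ≤-trans c≤b b≤a) dec))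

  appendColumns-fromColumns : ∀ Ps Ks → Decreasing (Ps ++ Ks) → appendColumns (fromColumns Ps) Ks ≡ fromColumns (Ps ++ Ks)
  appendColumns-fromColumns Ps [] _ = cong fromColumns (sym (++-identityʳ Ps))
  appendColumns-fromColumns Ps (K ∷ Ks) dec = begin
    appendColumns (appendColumn K (fromColumns Ps)) Ks  ≡⟨ cong (flip appendColumns Ks) (appendColumn-fromColumns Ps K (Linked-++⁻ˡ (Ps ∷ʳ K) dec′)) ⟩
    appendColumns (fromColumns (Ps ∷ʳ K)) Ks            ≡⟨ appendColumns-fromColumns (Ps ∷ʳ K) Ks dec′ ⟩
    fromColumns ((Ps ∷ʳ K) ++ Ks)                       ≡⟨ cong fromColumns (++-assoc Ps [ K ] Ks) ⟩
    fromColumns (Ps ++ K ∷ Ks)                          ∎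
    where
    open ≡-Reasoning
    dec′ : Decreasing ((Ps ∷ʳ K) ++ Ks)
    dec′ = subst Decreasing (sym (++-assoc Ps [ K ] Ks)) dec

  rect-normal : ∀ s → Normal s → rect S (letters s) ≡ fromColumns (map column s)
  rect-normal [] _ = refl
  rect-normal (u ∷ s) normal =
    trans (insertWord-normal [] u s normal (Fits-[] (column u)))
          (appendColumns-fromColumns [] (map column (u ∷ s)) (Linked-map⁺ (Linked.map (Juxtaposable⇒length≤ _ _) normal)))

  splitFirstColumn : Tableau S → List Carrier × Tableau S
  splitFirstColumn [] = [] , []
  splitFirstColumn ([] ∷ T) = splitFirstColumn T
  splitFirstColumn ((p ∷ r) ∷ T) = let (P , T′) = splitFirstColumn T in p ∷ P , consNonEmpty r T′
    where
    consNonEmpty : List Carrier → Tableau S → Tableau S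
    consNonEmpty [] T′ = T′
    consNonEmpty (x ∷ r) T′ = (x ∷ r) ∷ T′

  splitFirstColumn-prependColumn : ∀ P T → length T ≤ℕ length P → All (NonEmpty S) T →
                                   splitFirstColumn (prependColumn P T) ≡ (P , T)
  splitFirstColumn-prependColumn [] [] _ _ = refl
  splitFirstColumn-prependColumn (p ∷ P) [] _ _ rewrite splitFirstColumn-prependColumn P [] z≤n [] = refl
  splitFirstColumn-prependColumn (p ∷ P) ((x ∷ r) ∷ T) (s≤s T≤P) (_ ∷ nonempty)
    rewrite splitFirstColumn-prependColumn P T T≤P nonempty = refl

  prependColumn-nonempty : ∀ P T → All (NonEmpty S) T → All (NonEmpty S) (prependColumn P T)
  prependColumn-nonempty [] T nonempty = nonempty
  prependColumn-nonempty (p ∷ P) [] _ = tt ∷ prependColumn-nonempty P [] []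
  prependColumn-nonempty (p ∷ P) (r ∷ T) (_ ∷ nonempty) = tt ∷ prependColumn-nonempty P T nonempty

  fromColumns-nonempty : ∀ Ks → All (NonEmpty S) (fromColumns Ks)
  fromColumns-nonempty [] = []
  fromColumns-nonempty (K ∷ Ks) = prependColumn-nonempty K (fromColumns Ks) (fromColumns-nonempty Ks)

  fromColumns-injective : ∀ Ks Ks′ → Decreasing Ks → Decreasing Ks′ → All (NonEmpty S) Ks → All (NonEmpty S) Ks′ →
                          fromColumns Ks ≡ fromColumns Ks′ → Ks ≡ Ks′
  fromColumns-injective [] [] _ _ _ _ _ = refl
  fromColumns-injective [] ([] ∷ _) _ _ _ (() ∷ _) _
  fromColumns-injective ([] ∷ _) [] _ _ (() ∷ _) _ _
  fromColumns-injective [] ((_ ∷ _) ∷ Ks′) _ _ _ _ eq with fromColumns Ks′ | eq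
  ... | [] | ()
  ... | _ ∷ _ | ()
  fromColumns-injective ((_ ∷ _) ∷ Ks) [] _ _ _ _ eq with fromColumns Ks | eq
  ... | [] | ()
  ... | _ ∷ _ | ()
  fromColumns-injective (K ∷ Ks) (K′ ∷ Ks′) dec dec′ (_ ∷ ne) (_ ∷ ne′) eq =
    cong₂ _∷_ (proj₁ split≡) (fromColumns-injective Ks Ks′ (Linked.tail dec) (Linked.tail dec′) ne ne′ (proj₂ split≡))
    where
    split : ∀ K Ks → Decreasing (K ∷ Ks) → splitFirstColumn (fromColumns (K ∷ Ks)) ≡ (K , fromColumns Ks)
    split K Ks dec = splitFirstColumn-prependColumn K (fromColumns Ks) (length-fromColumns K Ks dec) (fromColumns-nonempty Ks)
    split≡ : K ≡ K′ × fromColumns Ks ≡ fromColumns Ks′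
    split≡ = ,-injective (trans (sym (split K Ks dec)) (trans (cong splitFirstColumn eq) (split K′ Ks′ dec′)))

  Normal⇒Decreasing : ∀ {s} → Normal s → Decreasing (map column s)
  Normal⇒Decreasing normal = Linked-map⁺ (Linked.map (Juxtaposable⇒length≤ _ _) normal)

  columns-nonempty : ∀ s → All (NonEmpty S) (map column s)
  columns-nonempty s = map⁺ (All.universal nonempty s)
    where
    nonempty : ∀ u → NonEmpty S (column u)
    nonempty u with column-nonempty u
    ... | _ , _ , eq rewrite eq = tt

  normal-unique : ∀ s t → Normal s → Normal t → rect S (letters s) ≡ rect S (letters t) → s ≡ t
  normal-unique s t normal-s normal-t eq =
    map-injective column-injective
      (fromColumns-injective (map column s) (map column t) (Normal⇒Decreasing normal-s) (Normal⇒Decreasing normal-t)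
        (columns-nonempty s) (columns-nonempty t) (trans (sym (rect-normal s normal-s)) (trans eq (rect-normal t normal-t))))

  confluent : Confluent S
  confluent a↠b a↠c with normalise _ | normalise _
  ... | n , b↠n , normal-n | n′ , c↠n′ , normal-n′
    with normal-unique n n′ normal-n normal-n′
           (trans (sym (steps-rect b↠n)) (trans (sym (steps-rect a↠b)) (trans (steps-rect a↠c) (steps-rect c↠n′))))
  ... | refl = n , b↠n , c↠n′

  monoidIso : MonoidIso S
  monoidIso = letters , ε , (λ s t → ≡⇒≈ (letters-++ s t)) , (λ _ _ → Eq.gfold (Eq.isEquivalence (PStep S)) letters step-≈) ,
              reflect , (λ w → map (λ x → [ x ] , tt) w , ≡⇒≈ (letters-singletons w))
    where
    letters-singletons : ∀ w → letters (map (λ x → [ x ] , tt) w) ≡ w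
    letters-singletons [] = refl
    letters-singletons (x ∷ w) = cong (x ∷_) (letters-singletons w)
    reflect : ∀ s t → letters s ≈ letters t → _≈Col_ S s t
    reflect s t s≈t with normalise s | normalise t
    ... | n , s↠n , normal-n | n′ , t↠n′ , normal-n′
      with normal-unique n n′ normal-n normal-n′ (trans (sym (steps-rect s↠n)) (trans (≈-rect s≈t) (steps-rect t↠n′)))
    ... | refl = Star.map fwd s↠n ◅◅ Eq.symmetric (Step S) (Star.map fwd t↠n′)

theorem2p5 : (S : SignedAlphabet) → Terminating S × Confluent S × MonoidIso S
theorem2p5 S = terminating S , confluent S , monoidIso S
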